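{- Let $n\ge0$. Then the set of unlabeled (not necessarily connected) $1$-metamour-regular graphs with $2n$ vertices is in bijective correspondence with the set of integer partitions of $n+2$ with smallest part equal to $2$ and with one part $2$ of each partition marked.
   Context: Graphs are finite and simple; unlabeled means up to isomorphism. A vertex $v$ is a metamour of a vertex $w$ in $G$ if their distance in $G$ equals $2$ (in particular they lie in the same connected component). $G$ is $1$-metamour-regular if every vertex has exactly one metamour. An integer partition of a positive integer $m$ is a representation of $m$ as an unordered sum of positive integers (its parts). -}

module Defs where

open import Data.Bool using (Bool; T)
open import Data.Nat using (ℕ; _≤_; _≥_; _<_; _*_; _+_)
open import Data.Nat.Properties using (_≟_)
open import Data.Fin using (Fin; toℕ)
open import Data.List using (List; length; filter)
open import Data.Nat.ListAction using (sum)
open import Data.List.Relation.Unary.All using (All)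
open import Data.List.Relation.Unary.Linked using (Linked)
open import Data.List.Membership.Propositional using (_∈_)
open import Data.Product using (Σ; ∃; _×_; _,_)
open import Relation.Binary.PropositionalEquality using (_≡_)
open import Relation.Nullary using (¬_)
open import Function.Bundles using (_↔_; Inverse)

record Graph (m : ℕ) : Set where
  field
    adj    : Fin m → Fin m → Bool
    sym    : ∀ i j → adj i j ≡ adj j i
    irrefl : ∀ i → adj i i ≡ Data.Bool.false
open Graph public

Adj : ∀ {m} → Graph m → Fin m → Fin m → Set
Adj G i j = T (adj G i j)

-- Graph isomorphism (unlabeled graphs = graphs up to this relation)
_≅_ : ∀ {m} → Graph m → Graph m → Set
_≅_ {m} G H = Σ (Fin m ↔ Fin m) λ σ →
  ∀ i j → adj G i j ≡ adj H (Inverse.to σ i) (Inverse.to σ j)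

Metamour : ∀ {m} → Graph m → Fin m → Fin m → Set
Metamour G v w = ¬ (v ≡ w) × ¬ Adj G v w × ∃ λ u → Adj G v u × Adj G u w

OneMetamourRegular : ∀ {m} → Graph m → Set
OneMetamourRegular {m} G = ∀ v → ∃ λ w → Metamour G v w × (∀ w′ → Metamour G v w′ → w′ ≡ w)

-- integer partitions of N, represented canonically as non-increasing lists of positive parts
IsPartition : ℕ → List ℕ → Set
IsPartition N ps = All (1 ≤_) ps × Linked _≥_ ps × sum ps ≡ N

twos : List ℕ → ℕ
twos ps = length (filter (_≟ 2) ps)

record MarkedPartition (N : ℕ) : Set where
  field
    parts    : List ℕ
    isPart   : IsPartition N parts
    has2     : 2 ∈ parts
    allGe2   : All (2 ≤_) parts
    marked   : Fin (twos parts)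
open MarkedPartition public

_≈ₘ_ : ∀ {N} → MarkedPartition N → MarkedPartition N → Set
p ≈ₘ q = parts p ≡ parts q × toℕ (marked p) ≡ toℕ (marked q)

MRGraph : ℕ → Set
MRGraph m = Σ (Graph m) OneMetamourRegular

-- a bijection between unlabeled 1-MR graphs on m vertices (MR graphs modulo ≅)
-- and marked partitions of N (modulo ≈ₘ)
UnlabeledBijection : ℕ → ℕ → Set
UnlabeledBijection m N = Σ (MRGraph m → MarkedPartition N) λ f →
    (∀ G H → Data.Product.proj₁ G ≅ Data.Product.proj₁ H → f G ≈ₘ f H)
  × (∀ G H → f G ≈ₘ f H → Data.Product.proj₁ G ≅ Data.Product.proj₁ H)
  × (∀ p → ∃ λ G → f G ≈ₘ p)

-- In a 1-metamour-regular graph the metamour map is a fixed-point-free involution.  The vertices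
-- within distance one of a pair {v , metamour v} form a connected component; if two of them are
-- distinct, non-adjacent and not metamours, the component is an induced P₄, and otherwise it is a
-- cocktail-party graph K₂,…,₂ on at least two pairs.  So the graphs are the disjoint unions of such
-- blocks, determined up to isomorphism by their multiset of blocks, which the numbers of vertices of
-- each degree recover.  A block on 2k vertices becomes a part k.  As P₄ and C₄ both give a part 2,
-- one adds an extra part 2 and marks it as the (t + 1)-st part 2, t being the number of P₄'s.

module Submission where

open import Data.Bool using (Bool; true; false; T; not; if_then_else_)
open import Data.Bool.Properties using (T-irrelevant; T-≡; T-not-≡; ¬-not; not-¬)
open import Data.Empty using (⊥; ⊥-elim)
open import Data.Fin using (Fin; toℕ; fromℕ<) renaming (zero to fzero; suc to fsuc)
import Data.Fin as Fin
open import Data.Fin.Patterns using (0F; 1F; 2F; 3F)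
import Data.Fin.Properties as Finₚ
open import Data.Fin.Permutation using (↔⇒≡)
open import Data.List using (List; []; _∷_; _++_; map; filter; length)
open import Data.List.Membership.Propositional using (_∈_)
import Data.List.Relation.Unary.All as All
open import Data.List.Relation.Unary.All using (All; []; _∷_)
import Data.List.Relation.Unary.All.Properties as Allₚ
open import Data.List.Relation.Unary.Linked using (Linked)
import Data.List.Relation.Unary.Sorted.TotalOrder.Properties as Sortedₚ
open import Data.List.Relation.Binary.Pointwise using (Pointwise-≡⇒≡)
import Data.List.Sort as Sort
open import Data.List.Membership.Propositional.Properties using (∈-∃++)
open import Data.List.Relation.Unary.Any using (here; there)
import Data.List.Relation.Binary.Permutation.Propositional.Properties as ↭ₚ
open import Data.List.Relation.Binary.Permutation.Propositional
  using (_↭_; ↭-refl; ↭-sym; ↭-trans; ↭-prep; ↭-reflexive; ↭⇒↭ₛ′)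
open import Data.Nat using (ℕ; zero; suc; _+_; _*_; _∸_; _≤_; _<_; _≥_; z≤n; s≤s)
import Data.Nat as ℕ
import Data.Nat.Properties as ℕₚ
open import Data.Nat.ListAction using (sum)
open import Data.Nat.ListAction.Properties using (sum-↭)
open import Data.Nat.Induction using (<-rec)
open import Data.Nat.Tactic.RingSolver using (solve-∀)
open import Data.Product using (Σ; ∃; _×_; _,_; proj₁; proj₂)
open import Data.Sum using (_⊎_; inj₁; inj₂; [_,_]′)
open import Data.Product.Function.Dependent.Propositional using (Σ-↔)
open import Data.Product.Function.NonDependent.Propositional using (_×-↔_)
open import Data.Sum.Function.Propositional using (_⊎-↔_)
open import Data.Unit using (tt)
open import Function using (_∘_)
open import Function.Bundles using (_↔_; _⇔_; Inverse; Equivalence; mk↔ₛ′; mk⇔)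
open import Function.Properties.Inverse using (↔-refl; ↔-sym; ↔-trans)
open import Function.Related.TypeIsomorphisms using (Σ-assoc; Σ-distribʳ-⊎)
open import Relation.Binary.Bundles using (DecTotalOrder)
import Relation.Binary.Construct.Flip.EqAndOrd as Flip
open import Relation.Binary.Definitions using (DecidableEquality)
open import Relation.Binary.PropositionalEquality
open import Relation.Nullary using (¬_; Dec; yes; no)
open import Relation.Nullary.Decidable
  using ( ⌊_⌋; T?; map′; _⊎-dec_; ⌊⌋-map′; toWitness; fromWitness; toWitnessFalse; fromWitnessFalse
        ; decidable-stable)

open import Defs renaming (sym to adj-sym)

↔-injective : ∀ {A B : Set} (e : A ↔ B) {x y} → Inverse.to e x ≡ Inverse.to e y → x ≡ y
↔-injective e {x} {y} eq =
  trans (sym (Inverse.strictlyInverseʳ e x)) (trans (cong (Inverse.from e) eq) (Inverse.strictlyInverseʳ e y))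

Adjacency : Set → Set
Adjacency V = V → V → Bool

Symmetricᵃ : ∀ {V} → Adjacency V → Set
Symmetricᵃ a = ∀ x y → a x y ≡ a y x

Irreflexiveᵃ : ∀ {V} → Adjacency V → Set
Irreflexiveᵃ a = ∀ x → a x x ≡ false

infix 4 _≅ᵃ_

record _≅ᵃ_ {V W : Set} (a : Adjacency V) (b : Adjacency W) : Set where
  constructor iso
  field
    bijection : V ↔ W
    preserves : ∀ x y → a x y ≡ b (Inverse.to bijection x) (Inverse.to bijection y)

≅ᵃ-refl : ∀ {V} {a : Adjacency V} → a ≅ᵃ a
≅ᵃ-refl = iso ↔-refl λ _ _ → refl

≅ᵃ-sym : ∀ {V W} {a : Adjacency V} {b : Adjacency W} → a ≅ᵃ b → b ≅ᵃ a
≅ᵃ-sym {b = b} (iso σ p) = iso (↔-sym σ) λ x y →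
  sym (trans (p (from x) (from y)) (cong₂ b (strictlyInverseˡ x) (strictlyInverseˡ y)))
  where open Inverse σ

≅ᵃ-trans : ∀ {U V W} {a : Adjacency U} {b : Adjacency V} {c : Adjacency W} →
           a ≅ᵃ b → b ≅ᵃ c → a ≅ᵃ c
≅ᵃ-trans (iso σ p) (iso τ q) = iso (↔-trans σ τ) λ x y → trans (p x y) (q _ _)

≅⇒≅ᵃ : ∀ {m} {G H : Graph m} → G ≅ H → adj G ≅ᵃ adj H
≅⇒≅ᵃ (σ , p) = iso σ p

≅ᵃ⇒≅ : ∀ {m} {G H : Graph m} → adj G ≅ᵃ adj H → G ≅ H
≅ᵃ⇒≅ (iso σ p) = σ , p

infixr 5 _⊕_

_⊕_ : ∀ {V W} → Adjacency V → Adjacency W → Adjacency (V ⊎ W)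
(a ⊕ b) (inj₁ x) (inj₁ y) = a x y
(a ⊕ b) (inj₁ x) (inj₂ y) = false
(a ⊕ b) (inj₂ x) (inj₁ y) = false
(a ⊕ b) (inj₂ x) (inj₂ y) = b x y

⊕-cong : ∀ {A B C D} {a : Adjacency A} {b : Adjacency B} {c : Adjacency C} {d : Adjacency D} →
         a ≅ᵃ c → b ≅ᵃ d → a ⊕ b ≅ᵃ c ⊕ d
⊕-cong (iso σ p) (iso τ q) = iso (σ ⊎-↔ τ) λ where
  (inj₁ x) (inj₁ y) → p x y
  (inj₁ x) (inj₂ y) → refl
  (inj₂ x) (inj₁ y) → refl
  (inj₂ x) (inj₂ y) → q x y

⊎-swapˡ : ∀ {X Y Z : Set} → X ⊎ (Y ⊎ Z) → Y ⊎ (X ⊎ Z)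
⊎-swapˡ (inj₁ x) = inj₂ (inj₁ x)
⊎-swapˡ (inj₂ (inj₁ y)) = inj₁ y
⊎-swapˡ (inj₂ (inj₂ z)) = inj₂ (inj₂ z)

⊎-swapˡ-involutive : ∀ {X Y Z : Set} (s : X ⊎ (Y ⊎ Z)) → ⊎-swapˡ (⊎-swapˡ s) ≡ s
⊎-swapˡ-involutive (inj₁ x) = refl
⊎-swapˡ-involutive (inj₂ (inj₁ y)) = refl
⊎-swapˡ-involutive (inj₂ (inj₂ z)) = refl

⊕-swapˡ : ∀ {A B C} (a : Adjacency A) (b : Adjacency B) (c : Adjacency C) →
          a ⊕ (b ⊕ c) ≅ᵃ b ⊕ (a ⊕ c)
⊕-swapˡ a b c = iso (mk↔ₛ′ ⊎-swapˡ ⊎-swapˡ ⊎-swapˡ-involutive ⊎-swapˡ-involutive) λ where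
  (inj₁ x) (inj₁ y) → refl
  (inj₁ x) (inj₂ (inj₁ y)) → refl
  (inj₁ x) (inj₂ (inj₂ y)) → refl
  (inj₂ (inj₁ x)) (inj₁ y) → refl
  (inj₂ (inj₁ x)) (inj₂ (inj₁ y)) → refl
  (inj₂ (inj₁ x)) (inj₂ (inj₂ y)) → refl
  (inj₂ (inj₂ x)) (inj₁ y) → refl
  (inj₂ (inj₂ x)) (inj₂ (inj₁ y)) → refl
  (inj₂ (inj₂ x)) (inj₂ (inj₂ y)) → refl

-- `cocktail j` is the cocktail-party graph on j + 2 pairs: the vertex (s , i) is adjacent to
-- every vertex outside its pair i.
data Block : Set where
  path₄    : Block
  cocktail : ℕ → Block

BlockVertex : Block → Set
BlockVertex path₄ = Fin 4
BlockVertex (cocktail j) = Bool × Fin (2 + j)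

path₄-adj : Adjacency (Fin 4)
path₄-adj 0F 1F = true
path₄-adj 1F 0F = true
path₄-adj 1F 2F = true
path₄-adj 2F 1F = true
path₄-adj 2F 3F = true
path₄-adj 3F 2F = true
path₄-adj _ _ = false

cocktail-adj : ∀ k → Adjacency (Bool × Fin k)
cocktail-adj k x y = not ⌊ proj₂ x Fin.≟ proj₂ y ⌋

blockAdj : (b : Block) → Adjacency (BlockVertex b)
blockAdj path₄ = path₄-adj
blockAdj (cocktail j) = cocktail-adj (2 + j)

Vertex : List Block → Set
Vertex [] = ⊥
Vertex (b ∷ bs) = BlockVertex b ⊎ Vertex bs

blocksAdj : (bs : List Block) → Adjacency (Vertex bs)
blocksAdj [] ()
blocksAdj (b ∷ bs) = blockAdj b ⊕ blocksAdj bs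

path₄-adj-sym : Symmetricᵃ path₄-adj
path₄-adj-sym 0F 0F = refl
path₄-adj-sym 0F 1F = refl
path₄-adj-sym 0F 2F = refl
path₄-adj-sym 0F 3F = refl
path₄-adj-sym 1F 0F = refl
path₄-adj-sym 1F 1F = refl
path₄-adj-sym 1F 2F = refl
path₄-adj-sym 1F 3F = refl
path₄-adj-sym 2F 0F = refl
path₄-adj-sym 2F 1F = refl
path₄-adj-sym 2F 2F = refl
path₄-adj-sym 2F 3F = refl
path₄-adj-sym 3F 0F = refl
path₄-adj-sym 3F 1F = refl
path₄-adj-sym 3F 2F = refl
path₄-adj-sym 3F 3F = refl

path₄-adj-irrefl : Irreflexiveᵃ path₄-adj
path₄-adj-irrefl 0F = refl
path₄-adj-irrefl 1F = refl
path₄-adj-irrefl 2F = refl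
path₄-adj-irrefl 3F = refl

cocktail-adj-sym : ∀ k → Symmetricᵃ (cocktail-adj k)
cocktail-adj-sym k (_ , i) (_ , l) with i Fin.≟ l | l Fin.≟ i
... | yes _ | yes _ = refl
... | no _ | no _ = refl
... | yes i≡l | no l≢i = ⊥-elim (l≢i (sym i≡l))
... | no i≢l | yes l≡i = ⊥-elim (i≢l (sym l≡i))

cocktail-adj-irrefl : ∀ k → Irreflexiveᵃ (cocktail-adj k)
cocktail-adj-irrefl k (_ , i) with i Fin.≟ i
... | yes _ = refl
... | no i≢i = ⊥-elim (i≢i refl)

blocksAdj-sym : ∀ bs → Symmetricᵃ (blocksAdj bs)
blocksAdj-sym (path₄ ∷ bs) (inj₁ x) (inj₁ y) = path₄-adj-sym x y
blocksAdj-sym (cocktail j ∷ bs) (inj₁ x) (inj₁ y) = cocktail-adj-sym (2 + j) x y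
blocksAdj-sym (b ∷ bs) (inj₁ x) (inj₂ y) = refl
blocksAdj-sym (b ∷ bs) (inj₂ x) (inj₁ y) = refl
blocksAdj-sym (b ∷ bs) (inj₂ x) (inj₂ y) = blocksAdj-sym bs x y

blocksAdj-irrefl : ∀ bs → Irreflexiveᵃ (blocksAdj bs)
blocksAdj-irrefl (path₄ ∷ bs) (inj₁ x) = path₄-adj-irrefl x
blocksAdj-irrefl (cocktail j ∷ bs) (inj₁ x) = cocktail-adj-irrefl (2 + j) x
blocksAdj-irrefl (b ∷ bs) (inj₂ x) = blocksAdj-irrefl bs x

↭⇒≅ᵃ : ∀ {bs bs′} → bs ↭ bs′ → blocksAdj bs ≅ᵃ blocksAdj bs′
↭⇒≅ᵃ _↭_.refl = ≅ᵃ-refl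
↭⇒≅ᵃ (_↭_.prep b p) = ⊕-cong ≅ᵃ-refl (↭⇒≅ᵃ p)
↭⇒≅ᵃ {b ∷ c ∷ bs} (_↭_.swap b c p) =
  ≅ᵃ-trans (⊕-swapˡ (blockAdj b) (blockAdj c) (blocksAdj bs)) (⊕-cong ≅ᵃ-refl (⊕-cong ≅ᵃ-refl (↭⇒≅ᵃ p)))
↭⇒≅ᵃ (_↭_.trans p q) = ≅ᵃ-trans (↭⇒≅ᵃ p) (↭⇒≅ᵃ q)

-- For a `Graph` G, `IsMetamour (adj G)` and `OneMetamourRegularᵃ (adj G)` unfold to `Metamour G`
-- and `OneMetamourRegular G`.
IsMetamour : ∀ {V} → Adjacency V → V → V → Set
IsMetamour a v w = v ≢ w × ¬ T (a v w) × ∃ λ u → T (a v u) × T (a u w)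

OneMetamourRegularᵃ : ∀ {V} → Adjacency V → Set
OneMetamourRegularᵃ a = ∀ v → ∃ λ w → IsMetamour a v w × (∀ w′ → IsMetamour a v w′ → w′ ≡ w)

module _ {V W} {a : Adjacency V} {b : Adjacency W} (a≅b : a ≅ᵃ b) where
  open _≅ᵃ_ a≅b
  open Inverse bijection

  private
    adj-to : ∀ {x y} → T (a x y) → T (b (to x) (to y))
    adj-to {x} {y} = subst T (preserves x y)

    adj-to⁻ : ∀ {x y} → T (b (to x) (to y)) → T (a x y)
    adj-to⁻ {x} {y} = subst T (sym (preserves x y))

  IsMetamour-to : ∀ {x y} → IsMetamour a x y → IsMetamour b (to x) (to y)
  IsMetamour-to (x≢y , ¬xy , u , xu , uy) =
    (λ eq → x≢y (↔-injective bijection eq)) , (λ t → ¬xy (adj-to⁻ t)) , to u , adj-to xu , adj-to uy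

  IsMetamour-to⁻ : ∀ {x y} → IsMetamour b (to x) (to y) → IsMetamour a x y
  IsMetamour-to⁻ {x} {y} (x≢y , ¬xy , u , xu , uy) =
    (λ eq → x≢y (cong to eq)) , (λ t → ¬xy (adj-to t)) , from u ,
    adj-to⁻ (subst (T ∘ b (to x)) (sym (strictlyInverseˡ u)) xu) ,
    adj-to⁻ (subst (λ z → T (b z (to y))) (sym (strictlyInverseˡ u)) uy)

  oneMR-≅ᵃ : OneMetamourRegularᵃ b → OneMetamourRegularᵃ a
  oneMR-≅ᵃ regular v with regular (to v)
  ... | w , vw , unique =
    from w ,
    IsMetamour-to⁻ (subst (IsMetamour b (to v)) (sym (strictlyInverseˡ w)) vw) ,
    λ w′ vw′ → trans (sym (strictlyInverseʳ w′)) (cong from (unique (to w′) (IsMetamour-to vw′)))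

oneMR-⊕ : ∀ {V W} {a : Adjacency V} {b : Adjacency W} →
          OneMetamourRegularᵃ a → OneMetamourRegularᵃ b → OneMetamourRegularᵃ (a ⊕ b)
oneMR-⊕ {a = a} {b} regularᵃ regularᵇ (inj₁ v) with regularᵃ v
... | w , (v≢w , ¬vw , u , vu , uw) , unique =
  inj₁ w , ((λ { refl → v≢w refl }) , ¬vw , inj₁ u , vu , uw) , unique₁
  where
  unique₁ : ∀ w′ → IsMetamour (a ⊕ b) (inj₁ v) w′ → w′ ≡ inj₁ w
  unique₁ (inj₁ w′) (v≢w′ , ¬vw′ , inj₁ u′ , vu′ , uw′) =
    cong inj₁ (unique w′ ((λ { refl → v≢w′ refl }) , ¬vw′ , u′ , vu′ , uw′))
  unique₁ (inj₁ w′) (_ , _ , inj₂ u′ , () , _)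
  unique₁ (inj₂ w′) (_ , _ , inj₁ u′ , _ , ())
  unique₁ (inj₂ w′) (_ , _ , inj₂ u′ , () , _)
oneMR-⊕ {a = a} {b} regularᵃ regularᵇ (inj₂ v) with regularᵇ v
... | w , (v≢w , ¬vw , u , vu , uw) , unique =
  inj₂ w , ((λ { refl → v≢w refl }) , ¬vw , inj₂ u , vu , uw) , unique₂
  where
  unique₂ : ∀ w′ → IsMetamour (a ⊕ b) (inj₂ v) w′ → w′ ≡ inj₂ w
  unique₂ (inj₂ w′) (v≢w′ , ¬vw′ , inj₂ u′ , vu′ , uw′) =
    cong inj₂ (unique w′ ((λ { refl → v≢w′ refl }) , ¬vw′ , u′ , vu′ , uw′))
  unique₂ (inj₂ w′) (_ , _ , inj₁ u′ , () , _)
  unique₂ (inj₁ w′) (_ , _ , inj₂ u′ , _ , ())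
  unique₂ (inj₁ w′) (_ , _ , inj₁ u′ , () , _)

path₄-metamour : Fin 4 → Fin 4
path₄-metamour 0F = 2F
path₄-metamour 1F = 3F
path₄-metamour 2F = 0F
path₄-metamour 3F = 1F

path₄-isMetamour : ∀ v → IsMetamour path₄-adj v (path₄-metamour v)
path₄-isMetamour 0F = (λ ()) , (λ ()) , 1F , tt , tt
path₄-isMetamour 1F = (λ ()) , (λ ()) , 2F , tt , tt
path₄-isMetamour 2F = (λ ()) , (λ ()) , 1F , tt , tt
path₄-isMetamour 3F = (λ ()) , (λ ()) , 2F , tt , tt

path₄-metamour-unique : ∀ v w → IsMetamour path₄-adj v w → w ≡ path₄-metamour v
path₄-metamour-unique 0F 3F (_ , _ , 0F , () , _)
path₄-metamour-unique 0F 3F (_ , _ , 1F , _ , ())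
path₄-metamour-unique 0F 3F (_ , _ , 2F , () , _)
path₄-metamour-unique 0F 3F (_ , _ , 3F , () , _)
path₄-metamour-unique 3F 0F (_ , _ , 0F , () , _)
path₄-metamour-unique 3F 0F (_ , _ , 1F , () , _)
path₄-metamour-unique 3F 0F (_ , _ , 2F , _ , ())
path₄-metamour-unique 3F 0F (_ , _ , 3F , () , _)
path₄-metamour-unique 0F 2F _ = refl
path₄-metamour-unique 1F 3F _ = refl
path₄-metamour-unique 2F 0F _ = refl
path₄-metamour-unique 3F 1F _ = refl
path₄-metamour-unique 0F 0F (v≢v , _) = ⊥-elim (v≢v refl)
path₄-metamour-unique 1F 1F (v≢v , _) = ⊥-elim (v≢v refl)
path₄-metamour-unique 2F 2F (v≢v , _) = ⊥-elim (v≢v refl)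
path₄-metamour-unique 3F 3F (v≢v , _) = ⊥-elim (v≢v refl)
path₄-metamour-unique 0F 1F (_ , ¬vw , _) = ⊥-elim (¬vw tt)
path₄-metamour-unique 1F 0F (_ , ¬vw , _) = ⊥-elim (¬vw tt)
path₄-metamour-unique 1F 2F (_ , ¬vw , _) = ⊥-elim (¬vw tt)
path₄-metamour-unique 2F 1F (_ , ¬vw , _) = ⊥-elim (¬vw tt)
path₄-metamour-unique 2F 3F (_ , ¬vw , _) = ⊥-elim (¬vw tt)
path₄-metamour-unique 3F 2F (_ , ¬vw , _) = ⊥-elim (¬vw tt)

path₄-rows-distinct : ∀ i j → (∀ k → path₄-adj i k ≡ path₄-adj j k) → i ≡ j
path₄-rows-distinct 0F 0F _ = refl
path₄-rows-distinct 1F 1F _ = refl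
path₄-rows-distinct 2F 2F _ = refl
path₄-rows-distinct 3F 3F _ = refl
path₄-rows-distinct 0F 1F rows with () ← rows 0F
path₄-rows-distinct 0F 2F rows with () ← rows 3F
path₄-rows-distinct 0F 3F rows with () ← rows 1F
path₄-rows-distinct 1F 0F rows with () ← rows 0F
path₄-rows-distinct 1F 2F rows with () ← rows 0F
path₄-rows-distinct 1F 3F rows with () ← rows 0F
path₄-rows-distinct 2F 0F rows with () ← rows 3F
path₄-rows-distinct 2F 1F rows with () ← rows 0F
path₄-rows-distinct 2F 3F rows with () ← rows 1F
path₄-rows-distinct 3F 0F rows with () ← rows 1F
path₄-rows-distinct 3F 1F rows with () ← rows 0F
path₄-rows-distinct 3F 2F rows with () ← rows 1F

oneMR-path₄ : OneMetamourRegularᵃ path₄-adj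
oneMR-path₄ v = path₄-metamour v , path₄-isMetamour v , path₄-metamour-unique v

otherPair : ∀ {j} → Fin (2 + j) → Fin (2 + j)
otherPair fzero = 1F
otherPair (fsuc _) = 0F

otherPair-≢ : ∀ {j} (i : Fin (2 + j)) → i ≢ otherPair i
otherPair-≢ fzero ()
otherPair-≢ (fsuc i) ()

-- The metamour of (s , i) is its partner (not s , i); a common neighbour lies in any other pair.
oneMR-cocktail : ∀ j → OneMetamourRegularᵃ (cocktail-adj (2 + j))
oneMR-cocktail j (s , i) =
  (not s , i) ,
  ((λ eq → not-¬ refl (cong proj₁ eq)) ,
   (λ t → toWitnessFalse t refl) ,
   (s , otherPair i) , fromWitnessFalse (otherPair-≢ i) , fromWitnessFalse (otherPair-≢ i ∘ sym)) ,
  unique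
  where
  unique : ∀ w → IsMetamour (cocktail-adj (2 + j)) (s , i) w → w ≡ (not s , i)
  unique (t , l) (v≢w , ¬vw , _)
    with refl ← decidable-stable (i Fin.≟ l) (¬vw ∘ fromWitnessFalse) =
    cong (_, i) (¬-not (v≢w ∘ cong (_, i) ∘ sym))

oneMR-blocks : ∀ bs → OneMetamourRegularᵃ (blocksAdj bs)
oneMR-blocks [] ()
oneMR-blocks (path₄ ∷ bs) = oneMR-⊕ oneMR-path₄ (oneMR-blocks bs)
oneMR-blocks (cocktail j ∷ bs) = oneMR-⊕ (oneMR-cocktail j) (oneMR-blocks bs)

T-not⇒¬T : ∀ {b} → T (not b) → ¬ T b
T-not⇒¬T {false} _ ()

¬T⇒T-not : ∀ {b} → ¬ T b → T (not b)
¬T⇒T-not {true} ¬t = ¬t tt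
¬T⇒T-not {false} _ = tt

T⇒≡true : ∀ {b} → T b → b ≡ true
T⇒≡true = Equivalence.to T-≡

¬T⇒≡false : ∀ {b} → ¬ T b → b ≡ false
¬T⇒≡false = Equivalence.to T-not-≡ ∘ ¬T⇒T-not

fromBool : Bool → ℕ
fromBool true = 1
fromBool false = 0

count : ∀ {m} → (Fin m → Bool) → ℕ
count {zero} P = 0
count {suc m} P = fromBool (P fzero) + count (P ∘ fsuc)

count-cong : ∀ {m} {P Q : Fin m → Bool} → (∀ i → P i ≡ Q i) → count P ≡ count Q
count-cong {zero} _ = refl
count-cong {suc m} P≡Q = cong₂ _+_ (cong fromBool (P≡Q fzero)) (count-cong (P≡Q ∘ fsuc))

count-complement : ∀ {m} (P : Fin m → Bool) → count P + count (not ∘ P) ≡ m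
count-complement {zero} P = refl
count-complement {suc m} P with P fzero | count-complement (P ∘ fsuc)
... | true | eq = cong suc eq
... | false | eq = trans (ℕₚ.+-suc (count (P ∘ fsuc)) _) (cong suc eq)

count-pos : ∀ {m} (P : Fin m → Bool) i → T (P i) → 1 ≤ count P
count-pos P fzero t with P fzero
... | true = s≤s z≤n
count-pos P (fsuc i) t = ℕₚ.≤-trans (count-pos (P ∘ fsuc) i t) (ℕₚ.m≤n+m _ (fromBool (P fzero)))

T↔Fin-fromBool : ∀ b → T b ↔ Fin (fromBool b)
T↔Fin-fromBool true = mk↔ₛ′ (λ _ → fzero) (λ _ → tt) (λ { fzero → refl ; (fsuc ()) }) (λ _ → refl)
T↔Fin-fromBool false = mk↔ₛ′ (λ ()) (λ ()) (λ ()) (λ ())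

Σ-Fin-suc : ∀ {m} (Q : Fin (suc m) → Set) → Σ (Fin (suc m)) Q ↔ (Q fzero ⊎ Σ (Fin m) (Q ∘ fsuc))
Σ-Fin-suc Q = mk↔ₛ′
  (λ { (fzero , q) → inj₁ q ; (fsuc i , q) → inj₂ (i , q) })
  (λ { (inj₁ q) → fzero , q ; (inj₂ (i , q)) → fsuc i , q })
  (λ { (inj₁ q) → refl ; (inj₂ (i , q)) → refl })
  (λ { (fzero , q) → refl ; (fsuc i , q) → refl })

Σ-count : ∀ {m} (P : Fin m → Bool) → Σ (Fin m) (T ∘ P) ↔ Fin (count P)
Σ-count {zero} P = mk↔ₛ′ (λ { (() , _) }) (λ ()) (λ ()) (λ { (() , _) })
Σ-count {suc m} P =
  ↔-trans (Σ-Fin-suc (T ∘ P))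
    (↔-trans (T↔Fin-fromBool (P fzero) ⊎-↔ Σ-count (P ∘ fsuc)) (↔-sym Finₚ.+↔⊎))

Sub : ∀ {V : Set} → (V → Bool) → Set
Sub {V} S = Σ V (T ∘ S)

Sub-≡ : ∀ {V} {S : V → Bool} {x y : V} {p : T (S x)} {q : T (S y)} → x ≡ y → _≡_ {A = Sub S} (x , p) (y , q)
Sub-≡ refl = cong (_ ,_) (T-irrelevant _ _)

≡⇒T↔ : ∀ {b c} → b ≡ c → T b ↔ T c
≡⇒T↔ refl = ↔-refl

Sub↔Fin : ∀ {V m} (e : V ↔ Fin m) (S : V → Bool) → Sub S ↔ Fin (count (S ∘ Inverse.from e))
Sub↔Fin e S =
  ↔-trans (Σ-↔ e (≡⇒T↔ (cong S (sym (Inverse.strictlyInverseʳ e _))))) (Σ-count (S ∘ Inverse.from e))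

restrict : ∀ {V} → Adjacency V → (S : V → Bool) → Adjacency (Sub S)
restrict a S (x , _) (y , _) = a x y

Closed : ∀ {V} → Adjacency V → (V → Bool) → Set
Closed a S = ∀ x y → T (S x) → T (a x y) → T (S y)

Closed-complement : ∀ {V} {a : Adjacency V} {S : V → Bool} → Symmetricᵃ a → Closed a S → Closed a (not ∘ S)
Closed-complement {a = a} {S} sym-a closed x y ¬Sx xy with S y in Sy
... | true = ⊥-elim (T-not⇒¬T ¬Sx (closed y x (subst T (sym Sy) tt) (subst T (sym-a x y) xy)))
... | false = tt

oneMR-restrict : ∀ {V} {a : Adjacency V} {S : V → Bool} →
                 Closed a S → OneMetamourRegularᵃ a → OneMetamourRegularᵃ (restrict a S)
oneMR-restrict {a = a} {S} closed regular (x , Sx) with regular x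
... | w , (x≢w , ¬xw , u , xu , uw) , unique =
  (w , Sw) , ((λ eq → x≢w (cong proj₁ eq)) , ¬xw , (u , Su) , xu , uw) , unique′
  where
  Su = closed x u Sx xu
  Sw = closed u w Su uw
  unique′ : ∀ w′ → IsMetamour (restrict a S) (x , Sx) w′ → w′ ≡ (w , Sw)
  unique′ (y , _) (x≢y , ¬xy , (u′ , _) , xu′ , u′y) =
    Sub-≡ (unique y ((λ eq → x≢y (Sub-≡ eq)) , ¬xy , u′ , xu′ , u′y))

module _ {V : Set} (S : V → Bool) where

  private
    toSide : (x : V) (b : Bool) → S x ≡ b → Sub S ⊎ Sub (not ∘ S)
    toSide x true eq = inj₁ (x , subst T (sym eq) tt)
    toSide x false eq = inj₂ (x , subst (T ∘ not) (sym eq) tt)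

    fromSide : Sub S ⊎ Sub (not ∘ S) → V
    fromSide (inj₁ (x , _)) = x
    fromSide (inj₂ (x , _)) = x

    fromSide-toSide : ∀ x b eq → fromSide (toSide x b eq) ≡ x
    fromSide-toSide x true eq = refl
    fromSide-toSide x false eq = refl

    toSide-inj₁ : ∀ x (p : T (S x)) b eq → toSide x b eq ≡ inj₁ (x , p)
    toSide-inj₁ x p true eq = cong inj₁ (Sub-≡ refl)
    toSide-inj₁ x p false eq = ⊥-elim (subst T eq p)

    toSide-inj₂ : ∀ x (p : T (not (S x))) b eq → toSide x b eq ≡ inj₂ (x , p)
    toSide-inj₂ x p false eq = cong inj₂ (Sub-≡ {S = not ∘ S} refl)
    toSide-inj₂ x p true eq = ⊥-elim (subst (T ∘ not) eq p)

  split : V ↔ (Sub S ⊎ Sub (not ∘ S))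
  split = mk↔ₛ′ (λ x → toSide x (S x) refl) fromSide
    (λ { (inj₁ (x , p)) → toSide-inj₁ x p (S x) refl ; (inj₂ (x , p)) → toSide-inj₂ x p (S x) refl })
    (λ x → fromSide-toSide x (S x) refl)

  ≅ᵃ-split : {a : Adjacency V} → Symmetricᵃ a → Closed a S → a ≅ᵃ restrict a S ⊕ restrict a (not ∘ S)
  ≅ᵃ-split {a} sym-a closed = iso split λ x y → go x y (S x) refl (S y) refl
    where
    across : ∀ x y → T (S x) → T (not (S y)) → a x y ≡ false
    across x y Sx ¬Sy with a x y in xy
    ... | true = ⊥-elim (T-not⇒¬T ¬Sy (closed x y Sx (subst T (sym xy) tt)))
    ... | false = refl

    go : ∀ x y bx (ex : S x ≡ bx) by (ey : S y ≡ by) →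
         a x y ≡ (restrict a S ⊕ restrict a (not ∘ S)) (toSide x bx ex) (toSide y by ey)
    go x y true ex true ey = refl
    go x y false ex false ey = refl
    go x y true ex false ey = across x y (subst T (sym ex) tt) (subst (T ∘ not) (sym ey) tt)
    go x y false ex true ey = trans (sym-a x y) (across y x (subst T (sym ey) tt) (subst (T ∘ not) (sym ex) tt))

<?-flip : ∀ {p q} → p ≢ q → ⌊ q ℕ.<? p ⌋ ≡ not ⌊ p ℕ.<? q ⌋
<?-flip {p} {q} p≢q with p ℕ.<? q | q ℕ.<? p
... | yes p<q | yes q<p = ⊥-elim (ℕₚ.<-asym p<q q<p)
... | yes _ | no _ = refl
... | no _ | yes _ = refl
... | no p≮q | no q≮p = ⊥-elim (p≢q (ℕₚ.≤-antisym (ℕₚ.≮⇒≥ q≮p) (ℕₚ.≮⇒≥ p≮q)))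

-- Each pair {x , partner x} is labelled through its member of smaller index, and the Bool records
-- whether a vertex is that member.
module CocktailRecognition
  {W : Set} {c : ℕ} (eW : W ↔ Fin c) (b : Adjacency W)
  (partner : W → W)
  (partner-involutive : ∀ x → partner (partner x) ≡ x)
  (partner-≢ : ∀ x → partner x ≢ x)
  (adj⇒ : ∀ x y → T (b x y) → x ≢ y × y ≢ partner x)
  (⇒adj : ∀ x y → x ≢ y → y ≢ partner x → T (b x y))
  where

  index : W → ℕ
  index x = toℕ (Inverse.to eW x)

  leader : W → Bool
  leader x = ⌊ index x ℕ.<? index (partner x) ⌋

  leader-partner : ∀ x → leader (partner x) ≡ not (leader x)
  leader-partner x =
    trans (cong (λ z → ⌊ index (partner x) ℕ.<? index z ⌋) (partner-involutive x))
          (<?-flip (λ eq → partner-≢ x (sym (↔-injective eW (Finₚ.toℕ-injective eq)))))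

  representative : W → W
  representative x = if leader x then x else partner x

  representative-leader : ∀ x → T (leader (representative x))
  representative-leader x with leader x in eq
  ... | true = subst T (sym eq) tt
  ... | false = subst T (sym (trans (leader-partner x) (cong not eq))) tt

  representative-of-leader : ∀ {x} → T (leader x) → representative x ≡ x
  representative-of-leader {x} t with leader x
  ... | true = refl

  representative-partner : ∀ x → representative (partner x) ≡ representative x
  representative-partner x with leader x in eq
  ... | true rewrite leader-partner x | eq = partner-involutive x
  ... | false rewrite leader-partner x | eq = refl

  representative-≡ : ∀ {x y} → representative x ≡ representative y → y ≡ x ⊎ y ≡ partner x
  representative-≡ {x} {y} eq with leader x | leader y
  ... | true | true = inj₁ (sym eq)
  ... | true | false = inj₂ (trans (sym (partner-involutive y)) (cong partner (sym eq)))
  ... | false | true = inj₂ (sym eq)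
  ... | false | false =
    inj₁ (trans (sym (partner-involutive y)) (trans (cong partner (sym eq)) (partner-involutive x)))

  pairs : ℕ
  pairs = count (leader ∘ Inverse.from eW)

  leaders↔ : Sub leader ↔ Fin pairs
  leaders↔ = Sub↔Fin eW leader

  pair : W → Fin pairs
  pair x = Inverse.to leaders↔ (representative x , representative-leader x)

  pair-≡ : ∀ {x y} → pair x ≡ pair y → y ≡ x ⊎ y ≡ partner x
  pair-≡ eq = representative-≡ (cong proj₁ (↔-injective leaders↔ eq))

  pair-partner : ∀ x → pair (partner x) ≡ pair x
  pair-partner x = cong (Inverse.to leaders↔) (Sub-≡ (representative-partner x))

  label : W → Bool × Fin pairs
  label x = leader x , pair x

  unlabel : Bool × Fin pairs → W
  unlabel (true , i) = proj₁ (Inverse.from leaders↔ i)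
  unlabel (false , i) = partner (proj₁ (Inverse.from leaders↔ i))

  private
    unlabel-label′ : ∀ x s → leader x ≡ s → unlabel (s , pair x) ≡ x
    unlabel-label′ x true eq =
      trans (cong proj₁ (Inverse.strictlyInverseʳ leaders↔ _)) (representative-of-leader (subst T (sym eq) tt))
    unlabel-label′ x false eq =
      trans (cong (partner ∘ proj₁) (Inverse.strictlyInverseʳ leaders↔ _))
            (trans (cong (λ s → partner (if s then x else partner x)) eq) (partner-involutive x))

    label-unlabel : ∀ l → label (unlabel l) ≡ l
    label-unlabel (true , i) =
      cong₂ _,_ (T⇒≡true t)
        (trans (cong (Inverse.to leaders↔) (Sub-≡ (representative-of-leader t)))
               (Inverse.strictlyInverseˡ leaders↔ i))
      where t = proj₂ (Inverse.from leaders↔ i)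
    label-unlabel (false , i) =
      cong₂ _,_ (trans (leader-partner _) (cong not (T⇒≡true t)))
        (trans (pair-partner _)
          (trans (cong (Inverse.to leaders↔) (Sub-≡ (representative-of-leader t)))
                 (Inverse.strictlyInverseˡ leaders↔ i)))
      where t = proj₂ (Inverse.from leaders↔ i)

  labelling : W ↔ (Bool × Fin pairs)
  labelling = mk↔ₛ′ label unlabel label-unlabel (λ x → unlabel-label′ x (leader x) refl)

  adj-labelled : ∀ x y → b x y ≡ cocktail-adj pairs (label x) (label y)
  adj-labelled x y with pair x Fin.≟ pair y
  ... | yes eq with pair-≡ eq
  ...   | inj₁ y≡x = ¬T⇒≡false λ t → proj₁ (adj⇒ x y t) (sym y≡x)
  ...   | inj₂ y≡x′ = ¬T⇒≡false λ t → proj₂ (adj⇒ x y t) y≡x′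
  adj-labelled x y | no ne =
    T⇒≡true (⇒adj x y (ne ∘ cong pair) (λ eq → ne (trans (sym (pair-partner x)) (cong pair (sym eq)))))

  ≅ᵃ-cocktail : ∀ x y → y ≢ x → y ≢ partner x → ∃ λ j → b ≅ᵃ cocktail-adj (2 + j)
  ≅ᵃ-cocktail x y y≢x y≢x′ = at-least-two-pairs (pair x) (pair y) pairs-differ (iso labelling adj-labelled)
    where
    pairs-differ : pair x ≢ pair y
    pairs-differ eq with pair-≡ eq
    ... | inj₁ e = y≢x e
    ... | inj₂ e = y≢x′ e
    at-least-two-pairs : ∀ {k} (i l : Fin k) → i ≢ l → b ≅ᵃ cocktail-adj k → ∃ λ j → b ≅ᵃ cocktail-adj (2 + j)
    at-least-two-pairs {suc zero} fzero fzero i≢l _ = ⊥-elim (i≢l refl)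
    at-least-two-pairs {suc (suc j)} _ _ _ b≅ = j , b≅

search-Fin : ∀ {m} {P Q : Fin m → Set} → (∀ i → P i ⊎ Q i) → ∃ P ⊎ (∀ i → Q i)
search-Fin {zero} d = inj₂ λ ()
search-Fin {suc m} d with d fzero | search-Fin (d ∘ fsuc)
... | inj₁ p | _ = inj₁ (fzero , p)
... | inj₂ q | inj₁ (i , p) = inj₁ (fsuc i , p)
... | inj₂ q | inj₂ qs = inj₂ λ { fzero → q ; (fsuc i) → qs i }

search : ∀ {V : Set} {m} → V ↔ Fin m → {P Q : V → Set} → (∀ x → P x ⊎ Q x) → ∃ P ⊎ (∀ x → Q x)
search e {Q = Q} d with search-Fin (d ∘ Inverse.from e)
... | inj₁ (i , p) = inj₁ (Inverse.from e i , p)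
... | inj₂ qs = inj₂ λ x → subst Q (Inverse.strictlyInverseʳ e x) (qs (Inverse.to e x))

search₂ : ∀ {V : Set} {m} → V ↔ Fin m → {P Q : V → V → Set} →
          (∀ x y → P x y ⊎ Q x y) → (∃ λ x → ∃ (P x)) ⊎ (∀ x y → Q x y)
search₂ e d = search e (λ x → search e (d x))

-- The structure of 1-metamour-regular graphs

module OneMetamourRegularStructure
  {V : Set} {m : ℕ} (e : V ↔ Fin m) (a : Adjacency V)
  (sym-a : Symmetricᵃ a) (irr-a : Irreflexiveᵃ a) (regular : OneMetamourRegularᵃ a)
  where

  infix 4 _≟_ _~_

  _≟_ : (x y : V) → Dec (x ≡ y)
  x ≟ y = map′ (↔-injective e) (cong (Inverse.to e)) (Inverse.to e x Fin.≟ Inverse.to e y)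

  _~_ : V → V → Set
  x ~ y = T (a x y)

  ~-sym : ∀ {x y} → x ~ y → y ~ x
  ~-sym {x} {y} = subst T (sym-a x y)

  ~-irrefl : ∀ {x} → ¬ x ~ x
  ~-irrefl {x} = subst T (irr-a x)

  ~⇒≢ : ∀ {x y} → x ~ y → x ≢ y
  ~⇒≢ x~y refl = ~-irrefl x~y

  metamour : V → V
  metamour v = proj₁ (regular v)

  metamour-isMetamour : ∀ v → IsMetamour a v (metamour v)
  metamour-isMetamour v = proj₁ (proj₂ (regular v))

  metamour-unique : ∀ {v w} → IsMetamour a v w → w ≡ metamour v
  metamour-unique {v} {w} = proj₂ (proj₂ (regular v)) w

  IsMetamour-sym : ∀ {v w} → IsMetamour a v w → IsMetamour a w v
  IsMetamour-sym (v≢w , v≁w , u , v~u , u~w) = v≢w ∘ sym , v≁w ∘ ~-sym , u , ~-sym u~w , ~-sym v~u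

  metamour-involutive : ∀ v → metamour (metamour v) ≡ v
  metamour-involutive v = sym (metamour-unique (IsMetamour-sym (metamour-isMetamour v)))

  metamour-≢ : ∀ v → metamour v ≢ v
  metamour-≢ v eq = proj₁ (metamour-isMetamour v) (sym eq)

  metamour-≁ : ∀ v → ¬ v ~ metamour v
  metamour-≁ v = proj₁ (proj₂ (metamour-isMetamour v))

  metamour-flip : ∀ {x y} → y ≡ metamour x → x ≡ metamour y
  metamour-flip {x} refl = sym (metamour-involutive x)

  common-neighbour⇒metamour : ∀ {z x y} → z ~ x → z ~ y → x ≢ y → ¬ x ~ y → y ≡ metamour x
  common-neighbour⇒metamour z~x z~y x≢y x≁y = metamour-unique (x≢y , x≁y , _ , ~-sym z~x , z~y)

  record InducedP₄ : Set where
    field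
      q₁ q₂ q₃ q₄ : V
      q₁~q₂ : q₁ ~ q₂
      q₂~q₃ : q₂ ~ q₃
      q₃~q₄ : q₃ ~ q₄
      q₁≁q₃ : ¬ q₁ ~ q₃
      q₂≁q₄ : ¬ q₂ ~ q₄
      q₁≁q₄ : ¬ q₁ ~ q₄

    q : Fin 4 → V
    q 0F = q₁
    q 1F = q₂
    q 2F = q₃
    q 3F = q₄

  reverse : InducedP₄ → InducedP₄
  reverse P = record
    { q₁ = q₄ ; q₂ = q₃ ; q₃ = q₂ ; q₄ = q₁
    ; q₁~q₂ = ~-sym q₃~q₄ ; q₂~q₃ = ~-sym q₂~q₃ ; q₃~q₄ = ~-sym q₁~q₂
    ; q₁≁q₃ = q₂≁q₄ ∘ ~-sym ; q₂≁q₄ = q₁≁q₃ ∘ ~-sym ; q₁≁q₄ = q₁≁q₄ ∘ ~-sym }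
    where open InducedP₄ P

  module P₄Neighbours (P : InducedP₄) where
    open InducedP₄ P

    q₁≢q₃ : q₁ ≢ q₃
    q₁≢q₃ refl = q₁≁q₄ q₃~q₄

    q₂≢q₄ : q₂ ≢ q₄
    q₂≢q₄ refl = q₁≁q₄ q₁~q₂

    q₁≢q₄ : q₁ ≢ q₄
    q₁≢q₄ refl = q₁≁q₃ (~-sym q₃~q₄)

    q₃-metamour : q₃ ≡ metamour q₁
    q₃-metamour = common-neighbour⇒metamour (~-sym q₁~q₂) q₂~q₃ q₁≢q₃ q₁≁q₃

    q₄-metamour : q₄ ≡ metamour q₂
    q₄-metamour = common-neighbour⇒metamour (~-sym q₂~q₃) q₃~q₄ q₂≢q₄ q₂≁q₄

    -- Any other neighbour z of q₁ is forced, step by step, to be adjacent to q₂, q₃ and q₄, and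
    -- then q₁ and q₄ would be metamours.
    end-neighbour : ∀ {z} → q₁ ~ z → z ≡ q₂
    end-neighbour {z} q₁~z with z ≟ q₂
    ... | yes z≡q₂ = z≡q₂
    ... | no z≢q₂ with T? (a z q₂)
    ...   | no z≁q₂ = ⊥-elim (q₁≁q₄ (subst (q₁ ~_) z≡q₄ q₁~z))
      where z≡q₄ = trans (common-neighbour⇒metamour q₁~q₂ q₁~z (z≢q₂ ∘ sym) (z≁q₂ ∘ ~-sym)) (sym q₄-metamour)
    ...   | yes z~q₂ with T? (a z q₃)
    ...     | no z≁q₃ = ⊥-elim (~-irrefl (subst (q₁ ~_) z≡q₁ q₁~z))
      where
      q₃≢z : q₃ ≢ z
      q₃≢z q₃≡z = q₁≁q₃ (subst (q₁ ~_) (sym q₃≡z) q₁~z)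
      z≡q₁ = trans (common-neighbour⇒metamour q₂~q₃ (~-sym z~q₂) q₃≢z (z≁q₃ ∘ ~-sym))
                   (sym (metamour-flip q₃-metamour))
    ...     | yes z~q₃ with T? (a z q₄)
    ...       | yes z~q₄ = ⊥-elim (~-irrefl (subst (q₃ ~_) q₄≡q₃ q₃~q₄))
      where q₄≡q₃ = trans (common-neighbour⇒metamour (~-sym q₁~z) z~q₄ q₁≢q₄ q₁≁q₄) (sym q₃-metamour)
    ...       | no z≁q₄ = ⊥-elim (z≢q₂ (trans (metamour-flip z-metamour) (sym (metamour-flip q₄-metamour))))
      where
      z-metamour = common-neighbour⇒metamour (~-sym z~q₃) q₃~q₄ (λ z≡q₄ → q₁≁q₄ (subst (q₁ ~_) z≡q₄ q₁~z)) z≁q₄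

    inner-neighbour : ∀ {z} → q₂ ~ z → z ≡ q₁ ⊎ z ≡ q₃
    inner-neighbour {z} q₂~z with z ≟ q₁ | z ≟ q₃
    ... | yes z≡q₁ | _ = inj₁ z≡q₁
    ... | no _ | yes z≡q₃ = inj₂ z≡q₃
    ... | no z≢q₁ | no z≢q₃ with T? (a q₁ z)
    ...   | yes q₁~z = ⊥-elim (~-irrefl (subst (q₂ ~_) (end-neighbour q₁~z) q₂~z))
    ...   | no q₁≁z = ⊥-elim (z≢q₃ (trans (common-neighbour⇒metamour (~-sym q₁~q₂) q₂~z (z≢q₁ ∘ sym) q₁≁z)
                                         (sym q₃-metamour)))

  module P₄Component (P : InducedP₄) where
    open InducedP₄ P
    open P₄Neighbours P using (end-neighbour; inner-neighbour)
    open P₄Neighbours (reverse P) using ()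
      renaming (end-neighbour to end-neighbourʳ; inner-neighbour to inner-neighbourʳ)

    onPath : V → Bool
    onPath x = ⌊ Finₚ.any? (λ i → x ≟ q i) ⌋

    onPath-at : ∀ {y} i → y ≡ q i → T (onPath y)
    onPath-at i y≡qi = fromWitness (i , y≡qi)

    closed : Closed a onPath
    closed x y x∈P x~y with toWitness x∈P
    ... | 0F , refl = onPath-at 1F (end-neighbour x~y)
    ... | 1F , refl = [ onPath-at 0F , onPath-at 2F ]′ (inner-neighbour x~y)
    ... | 2F , refl = [ onPath-at 3F , onPath-at 1F ]′ (inner-neighbourʳ x~y)
    ... | 3F , refl = onPath-at 2F (end-neighbourʳ x~y)

    induced : ∀ i j → path₄-adj i j ≡ a (q i) (q j)
    induced 0F 0F = sym (irr-a q₁)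
    induced 0F 1F = sym (T⇒≡true q₁~q₂)
    induced 0F 2F = sym (¬T⇒≡false q₁≁q₃)
    induced 0F 3F = sym (¬T⇒≡false q₁≁q₄)
    induced 1F 0F = sym (T⇒≡true (~-sym q₁~q₂))
    induced 1F 1F = sym (irr-a q₂)
    induced 1F 2F = sym (T⇒≡true q₂~q₃)
    induced 1F 3F = sym (¬T⇒≡false q₂≁q₄)
    induced 2F 0F = sym (¬T⇒≡false (q₁≁q₃ ∘ ~-sym))
    induced 2F 1F = sym (T⇒≡true (~-sym q₂~q₃))
    induced 2F 2F = sym (irr-a q₃)
    induced 2F 3F = sym (T⇒≡true q₃~q₄)
    induced 3F 0F = sym (¬T⇒≡false (q₁≁q₄ ∘ ~-sym))
    induced 3F 1F = sym (¬T⇒≡false (q₂≁q₄ ∘ ~-sym))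
    induced 3F 2F = sym (T⇒≡true (~-sym q₃~q₄))
    induced 3F 3F = sym (irr-a q₄)

    q-injective : ∀ {i j} → q i ≡ q j → i ≡ j
    q-injective {i} {j} qi≡qj = path₄-rows-distinct i j λ k →
      trans (induced i k) (trans (cong (λ x → a x (q k)) qi≡qj) (sym (induced j k)))

    point : Fin 4 → Sub onPath
    point i = q i , fromWitness (i , refl)

    locate : Sub onPath → Fin 4
    locate (_ , x∈P) = proj₁ (toWitness x∈P)

    ≅ᵃ-path₄ : restrict a onPath ≅ᵃ path₄-adj
    ≅ᵃ-path₄ = ≅ᵃ-sym (iso (mk↔ₛ′ point locate point-locate locate-point) induced)
      where
      point-locate : ∀ x → point (locate x) ≡ x
      point-locate (x , x∈P) = Sub-≡ (sym (proj₂ (toWitness x∈P)))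
      locate-point : ∀ i → locate (point i) ≡ i
      locate-point i = sym (q-injective (proj₂ (toWitness (proj₂ (point i)))))

  Near : V → V → V → Set
  Near c₁ c₂ x = c₁ ≡ x ⊎ c₁ ~ x ⊎ c₂ ≡ x ⊎ c₂ ~ x

  Near-swap : ∀ {c₁ c₂ x} → Near c₁ c₂ x → Near c₂ c₁ x
  Near-swap (inj₁ p) = inj₂ (inj₂ (inj₁ p))
  Near-swap (inj₂ (inj₁ p)) = inj₂ (inj₂ (inj₂ p))
  Near-swap (inj₂ (inj₂ (inj₁ p))) = inj₁ p
  Near-swap (inj₂ (inj₂ (inj₂ p))) = inj₂ (inj₁ p)

  -- The induced P₄ is c₁ c c₂ y or x c₁ c c₂.
  module FindP₄ {c₁ c₂ c} (c₁~c : c₁ ~ c) (c~c₂ : c ~ c₂) (c₂-metamour : c₂ ≡ metamour c₁) where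

    c₁≁c₂ : ¬ c₁ ~ c₂
    c₁≁c₂ = subst (λ z → ¬ c₁ ~ z) (sym c₂-metamour) (metamour-≁ c₁)

    beyond-c₂ : ∀ {y} → c₂ ~ y → ¬ c₁ ~ y → c₁ ≢ y → InducedP₄
    beyond-c₂ {y} c₂~y c₁≁y c₁≢y = record
      { q₁ = c₁ ; q₂ = c ; q₃ = c₂ ; q₄ = y
      ; q₁~q₂ = c₁~c ; q₂~q₃ = c~c₂ ; q₃~q₄ = c₂~y
      ; q₁≁q₃ = c₁≁c₂ ; q₁≁q₄ = c₁≁y
      ; q₂≁q₄ = λ c~y → ~-irrefl (subst (c₂ ~_)
          (trans (common-neighbour⇒metamour (~-sym c₁~c) c~y c₁≢y c₁≁y) (sym c₂-metamour)) c₂~y) }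

    beyond-c₁ : ∀ {x} → c₁ ~ x → ¬ x ~ c₂ → x ≢ c₂ → InducedP₄
    beyond-c₁ {x} c₁~x x≁c₂ x≢c₂ = record
      { q₁ = x ; q₂ = c₁ ; q₃ = c ; q₄ = c₂
      ; q₁~q₂ = ~-sym c₁~x ; q₂~q₃ = c₁~c ; q₃~q₄ = c~c₂
      ; q₂≁q₄ = c₁≁c₂ ; q₁≁q₄ = x≁c₂
      ; q₁≁q₃ = λ x~c → ~-irrefl (subst (c₁ ~_)
          (trans (metamour-flip (common-neighbour⇒metamour (~-sym x~c) c~c₂ x≢c₂ x≁c₂))
                 (sym (metamour-flip c₂-metamour))) c₁~x) }

    defect⇒P₄ : ∀ {x y} → c₁ ≡ x ⊎ c₁ ~ x → Near c₁ c₂ y →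
                x ≢ y → y ≢ metamour x → ¬ x ~ y → InducedP₄
    defect⇒P₄ (inj₁ refl) (inj₁ refl) x≢y _ _ = ⊥-elim (x≢y refl)
    defect⇒P₄ (inj₁ refl) (inj₂ (inj₁ c₁~y)) _ _ x≁y = ⊥-elim (x≁y c₁~y)
    defect⇒P₄ (inj₁ refl) (inj₂ (inj₂ (inj₁ refl))) _ y≢x′ _ = ⊥-elim (y≢x′ c₂-metamour)
    defect⇒P₄ (inj₁ refl) (inj₂ (inj₂ (inj₂ c₂~y))) x≢y _ x≁y = beyond-c₂ c₂~y x≁y x≢y
    defect⇒P₄ (inj₂ c₁~x) (inj₁ refl) _ _ x≁y = ⊥-elim (x≁y (~-sym c₁~x))
    defect⇒P₄ (inj₂ c₁~x) (inj₂ (inj₁ c₁~y)) x≢y y≢x′ x≁y =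
      ⊥-elim (y≢x′ (common-neighbour⇒metamour c₁~x c₁~y x≢y x≁y))
    defect⇒P₄ (inj₂ c₁~x) (inj₂ (inj₂ (inj₁ refl))) x≢y _ x≁y = beyond-c₁ c₁~x x≁y x≢y
    defect⇒P₄ (inj₂ c₁~x) (inj₂ (inj₂ (inj₂ c₂~y))) x≢y y≢x′ x≁y =
      beyond-c₂ c₂~y (λ c₁~y → y≢x′ (common-neighbour⇒metamour c₁~x c₁~y x≢y x≁y))
                     (λ { refl → x≁y (~-sym c₁~x) })

  Defect : (V → Bool) → V → V → Set
  Defect S x y = T (S x) × T (S y) × x ≢ y × y ≢ metamour x × ¬ x ~ y

  -- The vertices near v and its metamour w form a connected component; it is a cocktail-party
  -- graph unless it contains a defect, and a defect yields an induced P₄.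
  module Component (v : V) where

    w : V
    w = metamour v

    u : V
    u = proj₁ (proj₂ (proj₂ (metamour-isMetamour v)))

    v~u : v ~ u
    v~u = proj₁ (proj₂ (proj₂ (proj₂ (metamour-isMetamour v))))

    u~w : u ~ w
    u~w = proj₂ (proj₂ (proj₂ (proj₂ (metamour-isMetamour v))))

    near? : ∀ x → Dec (Near v w x)
    near? x = (v ≟ x) ⊎-dec T? (a v x) ⊎-dec (w ≟ x) ⊎-dec T? (a w x)

    inComponent : V → Bool
    inComponent x = ⌊ near? x ⌋

    closed : Closed a inComponent
    closed x y x∈C x~y = fromWitness (step (toWitness x∈C))
      where
      step : Near v w x → Near v w y
      step (inj₁ refl) = inj₂ (inj₁ x~y)
      step (inj₂ (inj₂ (inj₁ refl))) = inj₂ (inj₂ (inj₂ x~y))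
      step (inj₂ (inj₁ v~x)) with v ≟ y | T? (a v y)
      ... | yes v≡y | _ = inj₁ v≡y
      ... | no _ | yes v~y = inj₂ (inj₁ v~y)
      ... | no v≢y | no v≁y = inj₂ (inj₂ (inj₁ (sym (common-neighbour⇒metamour (~-sym v~x) x~y v≢y v≁y))))
      step (inj₂ (inj₂ (inj₂ w~x))) with w ≟ y | T? (a w y)
      ... | yes w≡y | _ = inj₂ (inj₂ (inj₁ w≡y))
      ... | no _ | yes w~y = inj₂ (inj₂ (inj₂ w~y))
      ... | no w≢y | no w≁y =
        inj₁ (sym (trans (common-neighbour⇒metamour (~-sym w~x) x~y w≢y w≁y) (metamour-involutive v)))

    metamour-closed : ∀ x → T (inComponent x) → T (inComponent (metamour x))
    metamour-closed x x∈C = closed _ _ (closed x _ x∈C x~u) u~x′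
      where
      x~u = proj₁ (proj₂ (proj₂ (proj₂ (metamour-isMetamour x))))
      u~x′ = proj₂ (proj₂ (proj₂ (proj₂ (metamour-isMetamour x))))

    v∈C : T (inComponent v)
    v∈C = fromWitness (inj₁ refl)

    u∈C : T (inComponent u)
    u∈C = fromWitness (inj₂ (inj₁ v~u))

    defect⇒P₄ : ∀ {x y} → Defect inComponent x y → InducedP₄
    defect⇒P₄ (x∈C , y∈C , x≢y , y≢x′ , x≁y) with toWitness x∈C
    ... | inj₁ v≡x = FindP₄.defect⇒P₄ v~u u~w refl (inj₁ v≡x) (toWitness y∈C) x≢y y≢x′ x≁y
    ... | inj₂ (inj₁ v~x) = FindP₄.defect⇒P₄ v~u u~w refl (inj₂ v~x) (toWitness y∈C) x≢y y≢x′ x≁y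
    ... | inj₂ (inj₂ (inj₁ w≡x)) =
      FindP₄.defect⇒P₄ (~-sym u~w) (~-sym v~u) (sym (metamour-involutive v))
        (inj₁ w≡x) (Near-swap (toWitness y∈C)) x≢y y≢x′ x≁y
    ... | inj₂ (inj₂ (inj₂ w~x)) =
      FindP₄.defect⇒P₄ (~-sym u~w) (~-sym v~u) (sym (metamour-involutive v))
        (inj₂ w~x) (Near-swap (toWitness y∈C)) x≢y y≢x′ x≁y

    NoDefect : V → V → Set
    NoDefect x y = T (inComponent x) → T (inComponent y) → x ≢ y → y ≢ metamour x → x ~ y

    defect? : ∀ x y → Defect inComponent x y ⊎ NoDefect x y
    defect? x y with T? (inComponent x) | T? (inComponent y) | x ≟ y | y ≟ metamour x | T? (a x y)
    ... | _ | _ | _ | _ | yes x~y = inj₂ λ _ _ _ _ → x~y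
    ... | yes x∈C | yes y∈C | no x≢y | no y≢x′ | no x≁y = inj₁ (x∈C , y∈C , x≢y , y≢x′ , x≁y)
    ... | no x∉C | _ | _ | _ | no _ = inj₂ λ x∈C → ⊥-elim (x∉C x∈C)
    ... | yes _ | no y∉C | _ | _ | no _ = inj₂ λ _ y∈C → ⊥-elim (y∉C y∈C)
    ... | yes _ | yes _ | yes x≡y | _ | no _ = inj₂ λ _ _ x≢y → ⊥-elim (x≢y x≡y)
    ... | yes _ | yes _ | no _ | yes y≡x′ | no _ = inj₂ λ _ _ _ y≢x′ → ⊥-elim (y≢x′ y≡x′)

    ≅ᵃ-cocktail : (∀ x y → NoDefect x y) → ∃ λ j → restrict a inComponent ≅ᵃ cocktail-adj (2 + j)
    ≅ᵃ-cocktail no-defect =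
      CocktailRecognition.≅ᵃ-cocktail (Sub↔Fin e inComponent) (restrict a inComponent) partner
        (λ (x , _) → Sub-≡ (metamour-involutive x))
        (λ (x , _) eq → metamour-≢ x (cong proj₁ eq))
        (λ (x , _) (y , _) x~y → (λ eq → ~⇒≢ x~y (cong proj₁ eq)) ,
                                  (λ eq → metamour-≁ x (subst (x ~_) (cong proj₁ eq) x~y)))
        (λ (x , x∈C) (y , y∈C) x≢y y≢x′ →
          no-defect x y x∈C y∈C (x≢y ∘ Sub-≡) (y≢x′ ∘ Sub-≡))
        (v , v∈C) (u , u∈C)
        (λ eq → ~⇒≢ v~u (sym (cong proj₁ eq)))
        (λ eq → ~⇒≢ u~w (cong proj₁ eq))
      where
      partner : Sub inComponent → Sub inComponent
      partner (x , x∈C) = metamour x , metamour-closed x x∈C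

  record BlockComponent : Set where
    field
      member   : V → Bool
      closed   : Closed a member
      witness  : V
      witness∈ : T (member witness)
      block    : Block
      ≅block   : restrict a member ≅ᵃ blockAdj block

  blockComponent : V → BlockComponent
  blockComponent v with search₂ e (Component.defect? v)
  ... | inj₁ (_ , _ , defect) = record
    { member = onPath ; closed = closed ; witness = InducedP₄.q₁ P ; witness∈ = fromWitness (0F , refl)
    ; block = path₄ ; ≅block = ≅ᵃ-path₄ }
    where
    P = Component.defect⇒P₄ v defect
    open P₄Component P
  ... | inj₂ no-defect = record
    { member = inComponent ; closed = closed ; witness = v ; witness∈ = v∈C
    ; block = cocktail (proj₁ cocktail-shape) ; ≅block = proj₂ cocktail-shape }
    where
    open Component v
    cocktail-shape = ≅ᵃ-cocktail no-defect

complement-smaller : ∀ {m} (P : Fin m → Bool) i → T (P i) → count (not ∘ P) < m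
complement-smaller P i Pi =
  subst (count (not ∘ P) <_) (count-complement P) (ℕₚ.+-monoˡ-≤ (count (not ∘ P)) (count-pos P i Pi))

DecomposesInto : ∀ {V : Set} → Adjacency V → Set
DecomposesInto a = ∃ λ bs → a ≅ᵃ blocksAdj bs

AllDecompose : ℕ → Set₁
AllDecompose m = ∀ {V : Set} (e : V ↔ Fin m) (a : Adjacency V) → Symmetricᵃ a → Irreflexiveᵃ a →
                 OneMetamourRegularᵃ a → DecomposesInto a

decompose : ∀ m → AllDecompose m
decompose = <-rec AllDecompose step
  where
  step : ∀ m → (∀ {k} → k < m → AllDecompose k) → AllDecompose m
  step zero _ e a _ _ _ = [] , iso (mk↔ₛ′ empty (λ ()) (λ ()) (⊥-elim ∘ empty)) (λ x → ⊥-elim (empty x))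
    where empty = λ x → Finₚ.¬Fin0 (Inverse.to e x)
  step (suc m) rec e a sym-a irr-a regular =
    block ∷ proj₁ rest ,
    ≅ᵃ-trans (≅ᵃ-split member sym-a closed) (⊕-cong ≅block (proj₂ rest))
    where
    open OneMetamourRegularStructure e a sym-a irr-a regular
    open BlockComponent (blockComponent (Inverse.from e fzero))
    rest = rec (complement-smaller (member ∘ Inverse.from e) (Inverse.to e witness)
                  (subst (T ∘ member) (sym (Inverse.strictlyInverseʳ e witness)) witness∈))
               (Sub↔Fin e (not ∘ member)) (restrict a (not ∘ member))
               (λ (x , _) (y , _) → sym-a x y) (λ (x , _) → irr-a x)
               (oneMR-restrict (Closed-complement sym-a closed) regular)

-- Degrees determine the blocks

module Multiplicity {A : Set} (_≟_ : DecidableEquality A) where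

  mult : A → List A → ℕ
  mult x xs = length (filter (_≟ x) xs)

  mult-∷ : ∀ x y ys → mult x (y ∷ ys) ≡ fromBool ⌊ y ≟ x ⌋ + mult x ys
  mult-∷ x y ys with y ≟ x
  ... | yes _ = refl
  ... | no _ = refl

  mult-self : ∀ x xs → mult x (x ∷ xs) ≡ suc (mult x xs)
  mult-self x xs with x ≟ x
  ... | yes _ = refl
  ... | no x≢x = ⊥-elim (x≢x refl)

  mult-other : ∀ x y ys → y ≢ x → mult x (y ∷ ys) ≡ mult x ys
  mult-other x y ys y≢x with y ≟ x
  ... | yes y≡x = ⊥-elim (y≢x y≡x)
  ... | no _ = refl

  mult-↭ : ∀ x {xs ys} → xs ↭ ys → mult x xs ≡ mult x ys
  mult-↭ x p = ↭ₚ.↭-length (↭ₚ.filter-↭ (_≟ x) p)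

  mult-pos⇒∈ : ∀ x xs → 1 ≤ mult x xs → x ∈ xs
  mult-pos⇒∈ x (y ∷ ys) pos with y ≟ x
  ... | yes refl = here refl
  ... | no _ = there (mult-pos⇒∈ x ys pos)

  mult⇒↭ : ∀ xs ys → (∀ z → mult z xs ≡ mult z ys) → xs ↭ ys
  mult⇒↭ [] [] _ = ↭-refl
  mult⇒↭ [] (y ∷ ys) same with () ← trans (same y) (mult-self y ys)
  mult⇒↭ (x ∷ xs) ys same
    with ys₁ , ys₂ , refl ←
           ∈-∃++ (mult-pos⇒∈ x ys (subst (1 ≤_) (trans (sym (mult-self x xs)) (same x)) (s≤s z≤n))) =
    ↭-trans (↭-prep x (mult⇒↭ xs (ys₁ ++ ys₂) same′)) (↭-sym (↭ₚ.shift x ys₁ ys₂))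
    where
    same′ : ∀ z → mult z xs ≡ mult z (ys₁ ++ ys₂)
    same′ z = ℕₚ.+-cancelˡ-≡ (fromBool ⌊ x ≟ z ⌋) _ _ (begin
      fromBool ⌊ x ≟ z ⌋ + mult z xs               ≡⟨ sym (mult-∷ z x xs) ⟩
      mult z (x ∷ xs)                              ≡⟨ same z ⟩
      mult z (ys₁ ++ x ∷ ys₂)                      ≡⟨ mult-↭ z (↭ₚ.shift x ys₁ ys₂) ⟩
      mult z (x ∷ ys₁ ++ ys₂)                      ≡⟨ mult-∷ z x (ys₁ ++ ys₂) ⟩
      fromBool ⌊ x ≟ z ⌋ + mult z (ys₁ ++ ys₂)     ∎)
      where open ≡-Reasoning

infix 4 _≟ᵇ_

_≟ᵇ_ : DecidableEquality Block
path₄ ≟ᵇ path₄ = yes refl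
path₄ ≟ᵇ cocktail _ = no λ ()
cocktail _ ≟ᵇ path₄ = no λ ()
cocktail j ≟ᵇ cocktail k = map′ (cong cocktail) (λ { refl → refl }) (j ℕ.≟ k)

open Multiplicity _≟ᵇ_ using () renaming
  ( mult to #blocks; mult-self to #blocks-self; mult-other to #blocks-other; mult-↭ to #blocks-↭
  ; mult⇒↭ to #blocks⇒↭)

neighbourhood-≅ᵃ : ∀ {V W} {a : Adjacency V} {b : Adjacency W} (a≅b : a ≅ᵃ b) x →
                   Σ V (T ∘ a x) ↔ Σ W (T ∘ b (Inverse.to (_≅ᵃ_.bijection a≅b) x))
neighbourhood-≅ᵃ (iso σ p) x = Σ-↔ σ (≡⇒T↔ (p x _))

cocktail-degree : ℕ → ℕ
cocktail-degree j = 2 + 2 * j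

blockDegree : (b : Block) → BlockVertex b → ℕ
blockDegree path₄ 0F = 1
blockDegree path₄ 1F = 2
blockDegree path₄ 2F = 2
blockDegree path₄ 3F = 1
blockDegree (cocktail j) _ = cocktail-degree j

degree : (bs : List Block) → Vertex bs → ℕ
degree (b ∷ bs) (inj₁ x) = blockDegree b x
degree (b ∷ bs) (inj₂ x) = degree bs x

count-≢ : ∀ {k} (i : Fin (suc k)) → count (λ l → not ⌊ i Fin.≟ l ⌋) ≡ k
count-≢ {k} fzero = count-true k
  where
  count-true : ∀ k → count {k} (λ _ → true) ≡ k
  count-true zero = refl
  count-true (suc k) = cong suc (count-true k)
count-≢ {suc k} (fsuc i) =
  cong suc (trans (count-cong λ l → cong not (⌊⌋-map′ (cong fsuc) Finₚ.suc-injective (i Fin.≟ l))) (count-≢ i))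

Bool×Fin↔ : ∀ k → (Bool × Fin k) ↔ Fin (2 * k)
Bool×Fin↔ k = ↔-trans (↔-sym Finₚ.2↔Bool ×-↔ ↔-refl) (↔-sym Finₚ.*↔×)

≡⇒Fin↔ : ∀ {k l} → k ≡ l → Fin k ↔ Fin l
≡⇒Fin↔ refl = ↔-refl

block-neighbours↔ : ∀ b x → Σ (BlockVertex b) (T ∘ blockAdj b x) ↔ Fin (blockDegree b x)
block-neighbours↔ path₄ 0F = Σ-count (path₄-adj 0F)
block-neighbours↔ path₄ 1F = Σ-count (path₄-adj 1F)
block-neighbours↔ path₄ 2F = Σ-count (path₄-adj 2F)
block-neighbours↔ path₄ 3F = Σ-count (path₄-adj 3F)
block-neighbours↔ (cocktail j) (_ , i) =
  ↔-trans Σ-assoc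
    (↔-trans (↔-refl ×-↔ ↔-trans (Σ-count (λ l → not ⌊ i Fin.≟ l ⌋)) (≡⇒Fin↔ (count-≢ i)))
             (↔-trans (Bool×Fin↔ (suc j)) (≡⇒Fin↔ (ℕₚ.*-suc 2 j))))

⊕-neighbours₁ : ∀ {V W} {a : Adjacency V} {b : Adjacency W} x → Σ (V ⊎ W) (T ∘ (a ⊕ b) (inj₁ x)) ↔ Σ V (T ∘ a x)
⊕-neighbours₁ x = mk↔ₛ′ (λ { (inj₁ y , t) → y , t ; (inj₂ _ , ()) }) (λ (y , t) → inj₁ y , t)
  (λ _ → refl) (λ { (inj₁ y , t) → refl ; (inj₂ _ , ()) })

⊕-neighbours₂ : ∀ {V W} {a : Adjacency V} {b : Adjacency W} x → Σ (V ⊎ W) (T ∘ (a ⊕ b) (inj₂ x)) ↔ Σ W (T ∘ b x)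
⊕-neighbours₂ x = mk↔ₛ′ (λ { (inj₂ y , t) → y , t ; (inj₁ _ , ()) }) (λ (y , t) → inj₂ y , t)
  (λ _ → refl) (λ { (inj₂ y , t) → refl ; (inj₁ _ , ()) })

neighbours↔ : ∀ bs x → Σ (Vertex bs) (T ∘ blocksAdj bs x) ↔ Fin (degree bs x)
neighbours↔ (b ∷ bs) (inj₁ x) = ↔-trans (⊕-neighbours₁ x) (block-neighbours↔ b x)
neighbours↔ (b ∷ bs) (inj₂ x) = ↔-trans (⊕-neighbours₂ x) (neighbours↔ bs x)

degree-≅ᵃ : ∀ {bs bs′} (i : blocksAdj bs ≅ᵃ blocksAdj bs′) x →
            degree bs x ≡ degree bs′ (Inverse.to (_≅ᵃ_.bijection i) x)
degree-≅ᵃ {bs} {bs′} i x =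
  ↔⇒≡ (↔-trans (↔-sym (neighbours↔ bs x)) (↔-trans (neighbourhood-≅ᵃ i x) (neighbours↔ bs′ _)))

#blockDegree : Block → ℕ → ℕ
#blockDegree path₄ d = count (λ i → blockDegree path₄ i ℕ.≡ᵇ d)
#blockDegree (cocktail j) d = if cocktail-degree j ℕ.≡ᵇ d then 2 * (2 + j) else 0

#degree : List Block → ℕ → ℕ
#degree [] d = 0
#degree (b ∷ bs) d = #blockDegree b d + #degree bs d

Σ-const↔ : ∀ {A : Set} {n} → A ↔ Fin n → (c : Bool) → Σ A (λ _ → T c) ↔ Fin (if c then n else 0)
Σ-const↔ e true = ↔-trans (mk↔ₛ′ proj₁ (_, tt) (λ _ → refl) (λ _ → refl)) e
Σ-const↔ e false = mk↔ₛ′ (λ ()) (λ ()) (λ ()) (λ ())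

#degree↔ : ∀ bs d → Σ (Vertex bs) (λ x → T (degree bs x ℕ.≡ᵇ d)) ↔ Fin (#degree bs d)
#degree↔ [] d = mk↔ₛ′ (λ ()) (λ ()) (λ ()) (λ ())
#degree↔ (b ∷ bs) d = ↔-trans Σ-distribʳ-⊎ (↔-trans (block b ⊎-↔ #degree↔ bs d) (↔-sym Finₚ.+↔⊎))
  where
  block : ∀ b → Σ (BlockVertex b) (λ x → T (blockDegree b x ℕ.≡ᵇ d)) ↔ Fin (#blockDegree b d)
  block path₄ = Σ-count (λ i → blockDegree path₄ i ℕ.≡ᵇ d)
  block (cocktail j) = Σ-const↔ (Bool×Fin↔ (2 + j)) (cocktail-degree j ℕ.≡ᵇ d)

#degree-≅ᵃ : ∀ {bs bs′} → blocksAdj bs ≅ᵃ blocksAdj bs′ → ∀ d → #degree bs d ≡ #degree bs′ d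
#degree-≅ᵃ {bs} {bs′} i d =
  ↔⇒≡ (↔-trans (↔-sym (#degree↔ bs d))
        (↔-trans (Σ-↔ (_≅ᵃ_.bijection i) (≡⇒T↔ (cong (ℕ._≡ᵇ d) (degree-≅ᵃ i _)))) (#degree↔ bs′ d)))

≡ᵇ-refl : ∀ n → (n ℕ.≡ᵇ n) ≡ true
≡ᵇ-refl n = T⇒≡true (ℕₚ.≡⇒≡ᵇ n n refl)

cocktail-degree-≡ᵇ : ∀ {j k} → j ≢ k → (cocktail-degree j ℕ.≡ᵇ cocktail-degree k) ≡ false
cocktail-degree-≡ᵇ {j} {k} j≢k =
  ¬T⇒≡false λ t → j≢k (ℕₚ.*-cancelˡ-≡ j k 2 (ℕₚ.suc-injective (ℕₚ.suc-injective (ℕₚ.≡ᵇ⇒≡ _ _ t))))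

-- Vertices of degree 1 lie only in P₄'s, vertices of degree 2 only in P₄'s and 4-cycles, and every
-- vertex of a larger cocktail-party graph has the degree 2 + 2 (1 + j) shared by no other block.
#degree-1 : ∀ bs → #degree bs 1 ≡ 2 * #blocks path₄ bs
#degree-1 [] = refl
#degree-1 (path₄ ∷ bs) = trans (cong (2 +_) (#degree-1 bs)) (sym (ℕₚ.*-suc 2 _))
#degree-1 (cocktail j ∷ bs) = #degree-1 bs

#degree-2 : ∀ bs → #degree bs 2 ≡ 2 * #blocks path₄ bs + 4 * #blocks (cocktail 0) bs
#degree-2 [] = refl
#degree-2 (path₄ ∷ bs) =
  trans (cong (2 +_) (#degree-2 bs)) (arith (#blocks path₄ bs) (#blocks (cocktail 0) bs))
  where
  arith : ∀ p c → 2 + (2 * p + 4 * c) ≡ 2 * suc p + 4 * c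
  arith = solve-∀
#degree-2 (cocktail zero ∷ bs) =
  trans (cong (4 +_) (#degree-2 bs)) (arith (#blocks path₄ bs) (#blocks (cocktail 0) bs))
  where
  arith : ∀ p c → 4 + (2 * p + 4 * c) ≡ 2 * p + 4 * suc c
  arith = solve-∀
#degree-2 (cocktail (suc j) ∷ bs) = #degree-2 bs

#degree-cocktail : ∀ j bs → #degree bs (cocktail-degree (suc j)) ≡ 2 * (3 + j) * #blocks (cocktail (suc j)) bs
#degree-cocktail j [] = sym (ℕₚ.*-zeroʳ (2 * (3 + j)))
#degree-cocktail j (path₄ ∷ bs) = #degree-cocktail j bs
#degree-cocktail j (cocktail k ∷ bs) with k ℕ.≟ suc j
... | yes refl rewrite ≡ᵇ-refl (cocktail-degree k) =
  trans (cong (2 * (3 + j) +_) (#degree-cocktail j bs))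
    (trans (sym (ℕₚ.*-suc (2 * (3 + j)) _)) (cong (2 * (3 + j) *_) (sym (#blocks-self (cocktail k) bs))))
... | no k≢ rewrite cocktail-degree-≡ᵇ k≢ =
  trans (#degree-cocktail j bs) (cong (2 * (3 + j) *_) 
    (sym (#blocks-other (cocktail (suc j)) (cocktail k) bs λ { refl → k≢ refl })))

degrees⇒#blocks : ∀ bs bs′ → (∀ d → #degree bs d ≡ #degree bs′ d) → ∀ b → #blocks b bs ≡ #blocks b bs′
degrees⇒#blocks bs bs′ same path₄ =
  ℕₚ.*-cancelˡ-≡ _ _ 2 (trans (sym (#degree-1 bs)) (trans (same 1) (#degree-1 bs′)))
degrees⇒#blocks bs bs′ same (cocktail zero) =
  ℕₚ.*-cancelˡ-≡ _ _ 4 (ℕₚ.+-cancelˡ-≡ (2 * #blocks path₄ bs) _ _ (begin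
    2 * #blocks path₄ bs + 4 * #blocks (cocktail 0) bs   ≡⟨ sym (#degree-2 bs) ⟩
    #degree bs 2                                         ≡⟨ same 2 ⟩
    #degree bs′ 2                                        ≡⟨ #degree-2 bs′ ⟩
    2 * #blocks path₄ bs′ + 4 * #blocks (cocktail 0) bs′ ≡⟨ cong (λ p → 2 * p + _) (sym same-path₄) ⟩
    2 * #blocks path₄ bs + 4 * #blocks (cocktail 0) bs′  ∎))
  where
  open ≡-Reasoning
  same-path₄ = degrees⇒#blocks bs bs′ same path₄
degrees⇒#blocks bs bs′ same (cocktail (suc j)) =
  ℕₚ.*-cancelˡ-≡ _ _ (2 * (3 + j))
    (trans (sym (#degree-cocktail j bs)) (trans (same _) (#degree-cocktail j bs′)))

≅ᵃ⇒↭ : ∀ {bs bs′} → blocksAdj bs ≅ᵃ blocksAdj bs′ → bs ↭ bs′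
≅ᵃ⇒↭ {bs} {bs′} i = #blocks⇒↭ bs bs′ (degrees⇒#blocks bs bs′ (#degree-≅ᵃ i))

-- Marked partitions

half : Block → ℕ
half path₄ = 2
half (cocktail j) = 2 + j

Vertex↔ : ∀ bs → Vertex bs ↔ Fin (2 * sum (map half bs))
Vertex↔ [] = mk↔ₛ′ (λ ()) (λ ()) (λ ()) (λ ())
Vertex↔ (b ∷ bs) =
  ↔-trans (block↔ b ⊎-↔ Vertex↔ bs)
    (↔-trans (↔-sym Finₚ.+↔⊎) (≡⇒Fin↔ (sym (ℕₚ.*-distribˡ-+ 2 (half b) (sum (map half bs))))))
  where
  block↔ : ∀ b → BlockVertex b ↔ Fin (2 * half b)
  block↔ path₄ = ↔-refl
  block↔ (cocktail j) = Bool×Fin↔ (2 + j)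

≥-decTotalOrder : DecTotalOrder _ _ _
≥-decTotalOrder = Flip.decTotalOrder ℕₚ.≤-decTotalOrder

open Sort ≥-decTotalOrder using (sort; sort-↭; sort-↗)

sorted-↭⇒≡ : ∀ {xs ys} → Linked _≥_ xs → Linked _≥_ ys → xs ↭ ys → xs ≡ ys
sorted-↭⇒≡ xs↘ ys↘ xs↭ys = Pointwise-≡⇒≡
  (Sortedₚ.↗↭↗⇒≋ (DecTotalOrder.totalOrder ≥-decTotalOrder) xs↘ ys↘ (↭⇒↭ₛ′ isEquivalence xs↭ys))

open Multiplicity ℕ._≟_ using () renaming
  (mult to #parts; mult-self to #parts-self; mult-other to #parts-other; mult-↭ to #parts-↭)

-- The extra part 2 is what makes every multiset of blocks, and in particular the empty one, yield a
-- partition with smallest part 2.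
partsOf : List Block → List ℕ
partsOf bs = sort (2 ∷ map half bs)

partsOf-↭ : ∀ bs → partsOf bs ↭ 2 ∷ map half bs
partsOf-↭ bs = sort-↭ (2 ∷ map half bs)

#2-half : ∀ bs → #parts 2 (map half bs) ≡ #blocks path₄ bs + #blocks (cocktail 0) bs
#2-half [] = refl
#2-half (path₄ ∷ bs) = cong suc (#2-half bs)
#2-half (cocktail zero ∷ bs) = trans (cong suc (#2-half bs)) (sym (ℕₚ.+-suc _ _))
#2-half (cocktail (suc j) ∷ bs) = #2-half bs

#>2-half : ∀ j bs → #parts (3 + j) (map half bs) ≡ #blocks (cocktail (suc j)) bs
#>2-half j [] = refl
#>2-half j (path₄ ∷ bs) = #>2-half j bs
#>2-half j (cocktail k ∷ bs) with k ℕ.≟ suc j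
... | yes refl = trans (#parts-self (2 + k) (map half bs)) (trans (cong suc (#>2-half j bs))
                   (sym (#blocks-self (cocktail k) bs)))
... | no k≢ = trans (#parts-other (3 + j) (2 + k) (map half bs) λ eq → k≢ (ℕₚ.+-cancelˡ-≡ 2 _ _ eq))
                (trans (#>2-half j bs) 
                  (sym (#blocks-other (cocktail (suc j)) (cocktail k) bs λ { refl → k≢ refl })))

twos-partsOf : ∀ bs → twos (partsOf bs) ≡ suc (#blocks path₄ bs + #blocks (cocktail 0) bs)
twos-partsOf bs = trans (#parts-↭ 2 (partsOf-↭ bs)) (cong suc (#2-half bs))

#path₄<twos : ∀ bs → #blocks path₄ bs < twos (partsOf bs)
#path₄<twos bs = subst (#blocks path₄ bs <_) (sym (twos-partsOf bs)) (s≤s (ℕₚ.m≤m+n _ _))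

partsOf-≥2 : ∀ bs → All (2 ≤_) (partsOf bs)
partsOf-≥2 bs = ↭ₚ.All-resp-↭ (↭-sym (partsOf-↭ bs)) (ℕₚ.≤-refl ∷ Allₚ.map⁺ (All.tabulate half≥2))
  where
  half≥2 : ∀ {b} → b ∈ bs → 2 ≤ half b
  half≥2 {path₄} _ = ℕₚ.≤-refl
  half≥2 {cocktail j} _ = ℕₚ.m≤m+n 2 j

markedPartition : ∀ n bs → sum (map half bs) ≡ n → MarkedPartition (n + 2)
markedPartition n bs size = record
  { parts = partsOf bs
  ; isPart = All.map (ℕₚ.≤-trans (s≤s z≤n)) (partsOf-≥2 bs) , sort-↗ _ ,
             trans (sum-↭ (partsOf-↭ bs)) (trans (cong (2 +_) size) (ℕₚ.+-comm 2 n))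
  ; has2 = ↭ₚ.∈-resp-↭ (↭-sym (partsOf-↭ bs)) (here refl)
  ; allGe2 = partsOf-≥2 bs
  ; marked = fromℕ< (#path₄<twos bs) }

toℕ-marked : ∀ n bs size → toℕ (marked (markedPartition n bs size)) ≡ #blocks path₄ bs
toℕ-marked n bs size = Finₚ.toℕ-fromℕ< (#path₄<twos bs)

markedPartition-↭ : ∀ {n bs bs′} size size′ → bs ↭ bs′ →
                    markedPartition n bs size ≈ₘ markedPartition n bs′ size′
markedPartition-↭ {n} {bs} {bs′} size size′ bs↭bs′ =
  sorted-↭⇒≡ (sort-↗ _) (sort-↗ _)
    (↭-trans (partsOf-↭ bs) (↭-trans (↭-prep 2 (↭ₚ.map⁺ half bs↭bs′)) (↭-sym (partsOf-↭ bs′)))) ,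
  trans (toℕ-marked n bs size) (trans (#blocks-↭ path₄ bs↭bs′) (sym (toℕ-marked n bs′ size′)))

-- The mark recovers the number of P₄'s, hence also the number of 4-cycles among the parts 2.
markedPartition-injective : ∀ {n bs bs′} size size′ →
                            markedPartition n bs size ≈ₘ markedPartition n bs′ size′ → bs ↭ bs′
markedPartition-injective {n} {bs} {bs′} size size′ (same-parts , same-mark) = #blocks⇒↭ bs bs′ same
  where
  halves : ∀ k → #parts k (2 ∷ map half bs) ≡ #parts k (2 ∷ map half bs′)
  halves k =
    trans (sym (#parts-↭ k (partsOf-↭ bs))) (trans (cong (#parts k) same-parts) (#parts-↭ k (partsOf-↭ bs′)))

  same-path₄ : #blocks path₄ bs ≡ #blocks path₄ bs′
  same-path₄ = trans (sym (toℕ-marked n bs size)) (trans same-mark (toℕ-marked n bs′ size′))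

  same : ∀ b → #blocks b bs ≡ #blocks b bs′
  same path₄ = same-path₄
  same (cocktail zero) = ℕₚ.+-cancelˡ-≡ (#blocks path₄ bs) _ _ (begin
    #blocks path₄ bs + #blocks (cocktail 0) bs   ≡⟨ sym (#2-half bs) ⟩
    #parts 2 (map half bs)                       ≡⟨ ℕₚ.suc-injective (halves 2) ⟩
    #parts 2 (map half bs′)                      ≡⟨ #2-half bs′ ⟩
    #blocks path₄ bs′ + #blocks (cocktail 0) bs′ ≡⟨ cong (_+ _) (sym same-path₄) ⟩
    #blocks path₄ bs + #blocks (cocktail 0) bs′  ∎)
    where open ≡-Reasoning
  same (cocktail (suc j)) = trans (sym (#>2-half j bs)) (trans (halves (3 + j)) (#>2-half j bs′))

partBlock : ℕ → Block
partBlock k = cocktail (k ∸ 2)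

-- Inverse to partsOf: the part 2 met after t P₄'s is the extra one added by partsOf.
blocksOf : List ℕ → ℕ → List Block
blocksOf [] t = []
blocksOf (2 ∷ ps) (suc t) = path₄ ∷ blocksOf ps t
blocksOf (2 ∷ ps) zero = map partBlock ps
blocksOf (k ∷ ps) t = partBlock k ∷ blocksOf ps t

half-partBlocks : ∀ {ps} → All (2 ≤_) ps → map half (map partBlock ps) ≡ ps
half-partBlocks [] = refl
half-partBlocks (2≤k ∷ ps≥2) = cong₂ _∷_ (ℕₚ.m+[n∸m]≡n 2≤k) (half-partBlocks ps≥2)

#path₄-partBlocks : ∀ ps → #blocks path₄ (map partBlock ps) ≡ 0
#path₄-partBlocks [] = refl
#path₄-partBlocks (k ∷ ps) = #path₄-partBlocks ps

blocksOf-↭ : ∀ ps t → All (2 ≤_) ps → t < twos ps → 2 ∷ map half (blocksOf ps t) ↭ ps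
blocksOf-↭ (2 ∷ ps) (suc t) (_ ∷ ps≥2) (s≤s t<) = ↭-prep 2 (blocksOf-↭ ps t ps≥2 t<)
blocksOf-↭ (2 ∷ ps) zero (_ ∷ ps≥2) _ = ↭-reflexive (cong (2 ∷_) (half-partBlocks ps≥2))
blocksOf-↭ (suc (suc (suc k)) ∷ ps) t (_ ∷ ps≥2) t< =
  ↭-trans (_↭_.swap 2 (3 + k) ↭-refl) (↭-prep (3 + k) (blocksOf-↭ ps t ps≥2 t<))
blocksOf-↭ (0 ∷ _) _ (() ∷ _) _
blocksOf-↭ (1 ∷ _) _ (s≤s () ∷ _) _

blocksOf-#path₄ : ∀ ps t → All (2 ≤_) ps → t < twos ps → #blocks path₄ (blocksOf ps t) ≡ t
blocksOf-#path₄ (2 ∷ ps) (suc t) (_ ∷ ps≥2) (s≤s t<) = cong suc (blocksOf-#path₄ ps t ps≥2 t<)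
blocksOf-#path₄ (2 ∷ ps) zero _ _ = #path₄-partBlocks ps
blocksOf-#path₄ (suc (suc (suc k)) ∷ ps) t (_ ∷ ps≥2) t< = blocksOf-#path₄ ps t ps≥2 t<
blocksOf-#path₄ (0 ∷ _) _ (() ∷ _) _
blocksOf-#path₄ (1 ∷ _) _ (s≤s () ∷ _) _

markedPartition-surjective : ∀ n (p : MarkedPartition (n + 2)) →
                             ∃ λ bs → Σ (sum (map half bs) ≡ n) λ size → markedPartition n bs size ≈ₘ p
markedPartition-surjective n p = bs , size ,
  sorted-↭⇒≡ (sort-↗ _) sorted (↭-trans (partsOf-↭ bs) halves↭) ,
  trans (toℕ-marked n bs size) (blocksOf-#path₄ (parts p) t (allGe2 p) t<)
  where
  t = toℕ (marked p)
  t< = Finₚ.toℕ<n (marked p)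
  sorted = proj₁ (proj₂ (isPart p))
  bs = blocksOf (parts p) t
  halves↭ = blocksOf-↭ (parts p) t (allGe2 p) t<
  size : sum (map half bs) ≡ n
  size = ℕₚ.+-cancelˡ-≡ 2 _ _ (trans (sum-↭ halves↭) (trans (proj₂ (proj₂ (isPart p))) (ℕₚ.+-comm n 2)))

relabel : ∀ {V : Set} {k} (e : V ↔ Fin k) (a : Adjacency V) → Symmetricᵃ a → Irreflexiveᵃ a →
          Σ (Graph k) λ G → adj G ≅ᵃ a
relabel e a sym-a irr-a =
  record { adj = λ i j → a (from i) (from j) ; sym = λ i j → sym-a (from i) (from j) ; irrefl = irr-a ∘ from } ,
  iso (↔-sym e) λ _ _ → refl
  where open Inverse e

blocksGraph : ∀ n bs → sum (map half bs) ≡ n → Σ (MRGraph (2 * n)) λ G → adj (proj₁ G) ≅ᵃ blocksAdj bs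
blocksGraph n bs size = (G , oneMR-≅ᵃ G≅ (oneMR-blocks bs)) , G≅
  where
  relabelled = relabel (↔-trans (Vertex↔ bs) (≡⇒Fin↔ (cong (2 *_) size))) (blocksAdj bs)
                       (blocksAdj-sym bs) (blocksAdj-irrefl bs)
  G = proj₁ relabelled
  G≅ = proj₂ relabelled

≈ₘ-trans : ∀ {N} {x y z : MarkedPartition N} → x ≈ₘ y → y ≈ₘ z → x ≈ₘ z
≈ₘ-trans (x≡y , x≈y) (y≡z , y≈z) = trans x≡y y≡z , trans x≈y y≈z

blocks-size : ∀ {V : Set} {n} {a : Adjacency V} → V ↔ Fin (2 * n) → ∀ bs → a ≅ᵃ blocksAdj bs →
              sum (map half bs) ≡ n
blocks-size {n = n} e bs (iso σ _) =
  ℕₚ.*-cancelˡ-≡ _ n 2 (↔⇒≡ (↔-trans (↔-sym (Vertex↔ bs)) (↔-trans (↔-sym σ) e)))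

module _ (n : ℕ) where

  decomposition : (G : MRGraph (2 * n)) → DecomposesInto (adj (proj₁ G))
  decomposition (G , regular) = decompose (2 * n) ↔-refl (adj G) (adj-sym G) (irrefl G) regular

  blocksOfGraph : MRGraph (2 * n) → List Block
  blocksOfGraph G = proj₁ (decomposition G)

  blocksOfGraph-size : ∀ G → sum (map half (blocksOfGraph G)) ≡ n
  blocksOfGraph-size G = blocks-size ↔-refl _ (proj₂ (decomposition G))

  classify : MRGraph (2 * n) → MarkedPartition (n + 2)
  classify G = markedPartition n (blocksOfGraph G) (blocksOfGraph-size G)

  ≅ᵃ-blocks⇒↭ : ∀ G bs → adj (proj₁ G) ≅ᵃ blocksAdj bs → blocksOfGraph G ↭ bs
  ≅ᵃ-blocks⇒↭ G bs G≅bs = ≅ᵃ⇒↭ (≅ᵃ-trans (≅ᵃ-sym (proj₂ (decomposition G))) G≅bs)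

  ≅⇔↭ : ∀ G H → (proj₁ G ≅ proj₁ H) ⇔ (blocksOfGraph G ↭ blocksOfGraph H)
  ≅⇔↭ G H = mk⇔
    (λ G≅H → ≅ᵃ-blocks⇒↭ G _ (≅ᵃ-trans (≅⇒≅ᵃ {G = proj₁ G} {proj₁ H} G≅H) (proj₂ (decomposition H))))
    (λ G↭H → ≅ᵃ⇒≅ {G = proj₁ G} {proj₁ H}
      (≅ᵃ-trans (proj₂ (decomposition G)) (≅ᵃ-trans (↭⇒≅ᵃ G↭H) (≅ᵃ-sym (proj₂ (decomposition H))))))

  classify-respects-≅ : ∀ G H → proj₁ G ≅ proj₁ H → classify G ≈ₘ classify H
  classify-respects-≅ G H G≅H =
    markedPartition-↭ (blocksOfGraph-size G) (blocksOfGraph-size H) (Equivalence.to (≅⇔↭ G H) G≅H)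

  classify-reflects-≅ : ∀ G H → classify G ≈ₘ classify H → proj₁ G ≅ proj₁ H
  classify-reflects-≅ G H same =
    Equivalence.from (≅⇔↭ G H) (markedPartition-injective (blocksOfGraph-size G) (blocksOfGraph-size H) same)

  classify-surjective : ∀ μ → ∃ λ G → classify G ≈ₘ μ
  classify-surjective μ with markedPartition-surjective n μ
  ... | bs , size , bs↦μ with blocksGraph n bs size
  ...   | G , G≅bs = G , ≈ₘ-trans {x = classify G} {markedPartition n bs size} {μ} G↦bs bs↦μ
    where
    G↦bs : classify G ≈ₘ markedPartition n bs size
    G↦bs = markedPartition-↭ (blocksOfGraph-size G) size (≅ᵃ-blocks⇒↭ G bs G≅bs)

corollary3p8 : (n : ℕ) → UnlabeledBijection (2 * n) (n + 2)
corollary3p8 n = classify n , classify-respects-≅ n , classify-reflects-≅ n , classify-surjective n
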